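{- Let $q$ be a prime power, $\gamma$ a primitive element of $\mathbb{F}_q$, $\ell$ a positive divisor of $q-1$, $s=(q-1)/\ell$, $r$ a positive integer and $t=\gcd(r,s)$. Choose $a_0,\dots,a_{\ell-1}$ independently and uniformly at random from $\mathbb{F}_q$, let $f=f^{r}_{a_0,\ldots,a_{\ell-1}}$ be the $r$-th order cyclotomic mapping of index $\ell$, and let $X_{t\ell}=|f(\mathbb{F}_q)|$ be the size of its value set. Then for $0\le k\le t\ell$, $${\mathbb P}(X_{t\ell}=1+ks/t) = {t\ell\choose k} \sum_{j=0}^{k} (-1)^{k -j} {k\choose j}\left(\frac{1}{q} + \frac{sj}{tq}\right)^{\ell}.$$
   Context: For $\ell\mid q-1$, let $C_0$ be the subgroup of $\mathbb{F}_q^*$ of nonzero $\ell$-th powers and $C_i=\gamma^iC_0$, $0\le i\le \ell-1$. The $r$-th order cyclotomic mapping $f^r_{a_0,\dots,a_{\ell-1}}$ of index $\ell$ is the map $\mathbb{F}_q\to\mathbb{F}_q$ with $0\mapsto0$ and $x\mapsto a_ix^r$ for $x\in C_i$. -}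

module Defs where

open import Level using (0ℓ)
open import Algebra.Bundles using (CommutativeRing; Semiring)
import Algebra.Definitions.RawSemiring as RS
open import Data.Nat as ℕ using (ℕ; zero; suc)
open import Data.Nat.Divisibility using (_∣_)
open import Data.Nat.Combinatorics using (_C_)
import Data.Nat.DivMod as ℕD
open import Data.Integer as ℤ using (ℤ)
open import Data.Rational as ℚ using (ℚ)
open import Data.Fin using (Fin; toℕ)
open import Data.Fin.Properties using (any?)
open import Data.Vec using (Vec; []; _∷_; lookup)
open import Data.List as List using (List; []; _∷_; filter; length; concatMap; map; allFin; upTo; foldr)
open import Data.Product using (Σ; ∃; _×_; _,_)
open import Relation.Nullary using (¬_; Dec; yes; no)
open import Relation.Nullary.Decidable using (¬?)
open import Relation.Nullary.Decidable using (_×-dec_)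
open import Relation.Binary using (Decidable)
open import Relation.Binary.PropositionalEquality using (_≡_)

record FiniteField : Set₁ where
  field
    commRing : CommutativeRing 0ℓ 0ℓ
  open CommutativeRing commRing public
  open RS (Semiring.rawSemiring semiring) public using (_^_)
  field
    1≉0      : ¬ (1# ≈ 0#)
    inverse  : ∀ x → ¬ (x ≈ 0#) → ∃ λ y → x * y ≈ 1#
    _≈?_     : Decidable _≈_
    size     : ℕ
    enum     : Fin size → Carrier
    enum-surj : ∀ x → ∃ λ i → enum i ≈ x
    enum-inj  : ∀ i j → enum i ≈ enum j → i ≡ j

  IsPrimitive : Carrier → Set
  IsPrimitive γ = ¬ (γ ≈ 0#) × (∀ x → ¬ (x ≈ 0#) → ∃ λ (e : ℕ) → γ ^ e ≈ x)

module _ (F : FiniteField) where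
  open FiniteField F

  InClass : (γ : Carrier) (ℓ : ℕ) → Fin ℓ → Carrier → Set
  InClass γ ℓ i x = ∃ λ (m : Fin size) → ¬ (enum m ≈ 0#) × (x ≈ γ ^ toℕ i * enum m ^ ℓ)

  inClass? : (γ : Carrier) (ℓ : ℕ) (i : Fin ℓ) (x : Carrier) → Dec (InClass γ ℓ i x)
  inClass? γ ℓ i x = any? (λ m → ¬? (enum m ≈? 0#) ×-dec (x ≈? (γ ^ toℕ i * enum m ^ ℓ)))

  -- The r-th order cyclotomic mapping f^r_{a_0,...,a_{ℓ-1}} of index ℓ:
  -- 0 ↦ 0 and x ↦ a_i x^r for x ∈ C_i.
  -- (The final 'no' branch never occurs when ℓ ∣ q-1 and γ is primitive.)
  cyclotomicMap : (γ : Carrier) (ℓ r : ℕ) (a : Fin ℓ → Carrier) → Carrier → Carrier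
  cyclotomicMap γ ℓ r a x with x ≈? 0#
  ... | yes _ = 0#
  ... | no _ with any? (λ i → inClass? γ ℓ i x)
  ...   | yes (i , _) = a i * x ^ r
  ...   | no _ = 0#

  valueSetSize : (Carrier → Carrier) → ℕ
  valueSetSize g = length (filter (λ y → any? (λ x → g (enum x) ≈? enum y)) (allFin size))

allVecs : (q n : ℕ) → List (Vec (Fin q) n)
allVecs q zero = [] ∷ []
allVecs q (suc n) = concatMap (λ v → map (_∷ v) (allFin q)) (allVecs q n)

countBy : ∀ {A : Set} {P : A → Set} → ((x : A) → Dec (P x)) → List A → ℕ
countBy P? xs = length (filter P? xs)

probValueSetSize : (F : FiniteField) (γ : FiniteField.Carrier F) (ℓ r N : ℕ) → ℚ
probValueSetSize F γ ℓ r N =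
  countBy (λ c → valueSetSize F (cyclotomicMap F γ ℓ r (λ i → FiniteField.enum F (lookup c i))) ℕ.≟ N)
          (allVecs (FiniteField.size F) ℓ)
  ÷ℕ (FiniteField.size F ℕ.^ ℓ)
  where
  _÷ℕ_ : ℕ → ℕ → ℚ
  n ÷ℕ zero = ℚ.0ℚ
  n ÷ℕ suc d = ℤ.+ n ℚ./ suc d

-- Total division helpers (only ever used with nonzero divisors).
_divℕ_ : ℕ → ℕ → ℕ
n divℕ zero = 0
n divℕ suc d = n ℕD./ suc d

_/ℚ_ : ℤ → ℕ → ℚ
z /ℚ zero = ℚ.0ℚ
z /ℚ suc d = z ℚ./ suc d

_^ℚ_ : ℚ → ℕ → ℚ
x ^ℚ zero = ℚ.1ℚ
x ^ℚ suc n = x ℚ.* (x ^ℚ n)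

sumTo : ℕ → (ℕ → ℚ) → ℚ
sumTo k g = foldr ℚ._+_ ℚ.0ℚ (map g (upTo (suc k)))

rhs : (q ℓ s t k : ℕ) → ℚ
rhs q ℓ s t k =
  ((ℤ.+ ((t ℕ.* ℓ) C k)) /ℚ 1) ℚ.*
  sumTo k (λ j → ((((ℚ.- ℚ.1ℚ) ^ℚ (k ℕ.∸ j)) ℚ.* ((ℤ.+ (k C j)) /ℚ 1))
                   ℚ.* ((((ℤ.+ 1) /ℚ q) ℚ.+ ((ℤ.+ (s ℕ.* j)) /ℚ (t ℕ.* q))) ^ℚ ℓ)))

-- Write y ≠ 0 as γ^β. For x in the class C_i the exponent of x^r runs over i r + ℓ r ℤ modulo q - 1 = ℓ s,
-- that is over i r + t ℓ ℤ since t = gcd(r, s); so y ∈ f(𝔽_q) iff β ≡ log a_i + i r (mod t ℓ) for some i with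
-- a_i ≠ 0. Call that residue the label of a_i. Each of the t ℓ labels is carried by exactly s/t elements of
-- 𝔽_q^*, so |f(𝔽_q)| = 1 + (s/t)·#(labels used by a). Building a one coordinate at a time, the number of vectors
-- using exactly k labels satisfies a linear recurrence, and the inclusion–exclusion expression
-- C(tℓ,k) Σ_j (-1)^(k-j) C(k,j) (1 + s j/t)^ℓ satisfies the same one; dividing by q^ℓ gives the formula.

module Submission where

open import Algebra.Bundles using (Semiring)

module IndexedSum {c ℓ} (R : Semiring c ℓ) where

  open import Data.Nat as ℕ using (ℕ; zero; suc; _<_)
  open import Data.Fin using (toℕ)
  open import Data.Fin.Properties using (toℕ<n)
  open Semiring R hiding (zero)
  open import Algebra.Properties.Semiring.Sum R
  open import Relation.Binary.Reasoning.Setoid setoid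

  ∑< : ℕ → (ℕ → Carrier) → Carrier
  ∑< n f = ∑[ i < n ] f (toℕ i)

  ∑<-cong : ∀ n {f g} → (∀ j → j < n → f j ≈ g j) → ∑< n f ≈ ∑< n g
  ∑<-cong n f≈g = sum-cong-≋ {n} (λ i → f≈g (toℕ i) (toℕ<n i))

  ∑<-distrib-+ : ∀ n f g → ∑< n (λ j → f j + g j) ≈ ∑< n f + ∑< n g
  ∑<-distrib-+ n f g = ∑-distrib-+ {n} (λ i → f (toℕ i)) (λ i → g (toℕ i))

  *-distribˡ-∑< : ∀ n x f → x * ∑< n f ≈ ∑< n (λ j → x * f j)
  *-distribˡ-∑< n x f = *-distribˡ-sum {n} x (λ i → f (toℕ i))

  ∑<-zero : ∀ n → ∑< n (λ _ → 0#) ≈ 0#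
  ∑<-zero n = sum-replicate-zero n

  ∑<-last : ∀ n f → ∑< (suc n) f ≈ ∑< n f + f n
  ∑<-last zero f = trans (+-identityʳ (f 0)) (sym (+-identityˡ (f 0)))
  ∑<-last (suc n) f = begin
    f 0 + ∑< (suc n) (λ j → f (suc j))          ≈⟨ +-congˡ (∑<-last n (λ j → f (suc j))) ⟩
    f 0 + (∑< n (λ j → f (suc j)) + f (suc n))  ≈⟨ sym (+-assoc _ _ _) ⟩
    ∑< (suc n) f + f (suc n)                    ∎

  ∑<-split : ∀ m n f → ∑< (m ℕ.+ n) f ≈ ∑< m f + ∑< n (λ j → f (m ℕ.+ j))
  ∑<-split zero n f = sym (+-identityˡ _)
  ∑<-split (suc m) n f = begin
    f 0 + ∑< (m ℕ.+ n) (λ j → f (suc j))                             ≈⟨ +-congˡ (∑<-split m n (λ j → f (suc j))) ⟩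
    f 0 + (∑< m (λ j → f (suc j)) + ∑< n (λ j → f (suc m ℕ.+ j)))    ≈⟨ sym (+-assoc _ _ _) ⟩
    ∑< (suc m) f + ∑< n (λ j → f (suc m ℕ.+ j))                      ∎

module Binomial where

  open import Data.Nat
  open import Data.Nat.Properties
  open import Data.Nat.Combinatorics
  open import Data.Nat.Solver using (module +-*-Solver)
  open +-*-Solver
  open import Relation.Binary.PropositionalEquality
  open import Relation.Nullary using (yes; no)
  open ≡-Reasoning

  [1+k]*[1+n]C[1+k]≡[1+n]*nCk : ∀ n k → suc k * (suc n C suc k) ≡ suc n * (n C k)
  [1+k]*[1+n]C[1+k]≡[1+n]*nCk zero zero = refl
  [1+k]*[1+n]C[1+k]≡[1+n]*nCk zero (suc k) =
    trans (cong (suc (suc k) *_) (k>n⇒nCk≡0 {1} (s<s (z<s {k})))) (*-zeroʳ (suc (suc k)))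
  [1+k]*[1+n]C[1+k]≡[1+n]*nCk (suc n) zero =
    trans (+-identityʳ _) (trans (nC1≡n (suc (suc n))) (sym (*-identityʳ _)))
  [1+k]*[1+n]C[1+k]≡[1+n]*nCk (suc n) (suc k) = begin
    suc (suc k) * (suc (suc n) C suc (suc k))
      ≡⟨ cong (suc (suc k) *_) (sym (nCk+nC[k+1]≡[n+1]C[k+1] (suc n) (suc k))) ⟩
    suc (suc k) * (a + b)
      ≡⟨ solve 3 (λ k a b → (con 2 :+ k) :* (a :+ b) := a :+ (con 1 :+ k) :* a :+ (con 2 :+ k) :* b) refl k a b ⟩
    a + suc k * a + suc (suc k) * b
      ≡⟨ cong₂ (λ x y → a + x + y) ([1+k]*[1+n]C[1+k]≡[1+n]*nCk n k) ([1+k]*[1+n]C[1+k]≡[1+n]*nCk n (suc k)) ⟩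
    a + suc n * (n C k) + suc n * (n C suc k)
      ≡⟨ solve 4 (λ a n c d → a :+ (con 1 :+ n) :* c :+ (con 1 :+ n) :* d := a :+ (con 1 :+ n) :* (c :+ d)) refl a n (n C k) (n C suc k) ⟩
    a + suc n * (n C k + n C suc k)
      ≡⟨ cong (λ x → a + suc n * x) (nCk+nC[k+1]≡[n+1]C[k+1] n k) ⟩
    suc (suc n) * a ∎
    where
    a = suc n C suc k
    b = suc n C suc (suc k)

  [1+n]Ck*[1+n∸k]≡[1+n]*nCk : ∀ n k → (suc n C k) * (suc n ∸ k) ≡ suc n * (n C k)
  [1+n]Ck*[1+n∸k]≡[1+n]*nCk n zero = *-comm 1 (suc n)
  [1+n]Ck*[1+n∸k]≡[1+n]*nCk n (suc k) with k ≤? n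
  ... | no k≰n = begin
    (suc n C suc k) * (n ∸ k) ≡⟨ cong (_* (n ∸ k)) (k>n⇒nCk≡0 (s<s (≰⇒> k≰n))) ⟩
    0                         ≡⟨ sym (*-zeroʳ (suc n)) ⟩
    suc n * 0                 ≡⟨ cong (suc n *_) (sym (k>n⇒nCk≡0 (m<n⇒m<1+n (≰⇒> k≰n)))) ⟩
    suc n * (n C suc k)       ∎
  ... | yes k≤n = +-cancelʳ-≡ (suc n * (n C k)) _ _ (begin
    X * (n ∸ k) + suc n * (n C k)     ≡⟨ cong (X * (n ∸ k) +_) (sym ([1+k]*[1+n]C[1+k]≡[1+n]*nCk n k)) ⟩
    X * (n ∸ k) + suc k * X           ≡⟨ solve 3 (λ X d k → X :* d :+ (con 1 :+ k) :* X := X :* (d :+ (con 1 :+ k))) refl X (n ∸ k) k ⟩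
    X * (n ∸ k + suc k)               ≡⟨ cong (X *_) (trans (+-suc (n ∸ k) k) (cong suc (m∸n+n≡m k≤n))) ⟩
    X * suc n                         ≡⟨ cong (_* suc n) (sym (nCk+nC[k+1]≡[n+1]C[k+1] n k)) ⟩
    (n C k + n C suc k) * suc n       ≡⟨ solve 3 (λ c d n → (c :+ d) :* n := n :* d :+ n :* c) refl (n C k) (n C suc k) (suc n) ⟩
    suc n * (n C suc k) + suc n * (n C k) ∎)
    where
    X = suc n C suc k

  nC[1+k]*[1+k]≡nCk*[n∸k] : ∀ n k → (n C suc k) * suc k ≡ (n C k) * (n ∸ k)
  nC[1+k]*[1+k]≡nCk*[n∸k] zero k = begin
    (0 C suc k) * suc k ≡⟨ cong (_* suc k) (k>n⇒nCk≡0 {0} (z<s {k})) ⟩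
    0                   ≡⟨ sym (*-zeroʳ (0 C k)) ⟩
    (0 C k) * 0         ≡⟨ cong ((0 C k) *_) (sym (0∸n≡0 k)) ⟩
    (0 C k) * (0 ∸ k)   ∎
  nC[1+k]*[1+k]≡nCk*[n∸k] (suc n) k = begin
    (suc n C suc k) * suc k   ≡⟨ *-comm _ (suc k) ⟩
    suc k * (suc n C suc k)   ≡⟨ [1+k]*[1+n]C[1+k]≡[1+n]*nCk n k ⟩
    suc n * (n C k)           ≡⟨ sym ([1+n]Ck*[1+n∸k]≡[1+n]*nCk n k) ⟩
    (suc n C k) * (suc n ∸ k) ∎

module Counting where

  open import Data.Nat
  open import Data.Nat.Properties
  open import Data.Nat.DivMod using (_%_; m<n⇒m%n≡m; [m+n]%n≡m%n)
  open import Data.Bool using (true; false; if_then_else_)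
  open import Data.Fin using (Fin; zero; suc)
  open import Data.Fin.Properties using (any?)
  open import Data.Vec using (Vec; _∷_; lookup)
  open import Data.List.Properties using (map-tabulate)
  open import Data.List using (List; []; _∷_; map; allFin; tabulate; concatMap; _++_)
  open import Data.Maybe using (Maybe; nothing; just; maybe)
  open import Data.Maybe.Properties using (≡-dec)
  open import Data.Product using (∃; _,_)
  open import Data.Sum using (_⊎_; inj₁; inj₂; [_,_])
  open import Data.Empty using (⊥-elim)
  open import Function using (_∘_)
  open import Relation.Nullary using (¬_; Dec; yes; no; does)
  open import Relation.Binary.PropositionalEquality hiding ([_])
  open import Data.Nat.Solver using (module +-*-Solver)
  open +-*-Solver
  open ≡-Reasoning
  open import Algebra.Properties.Semiring.Sum +-*-semiring using (sum-syntax; sum-cong-≗)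
  open IndexedSum +-*-semiring
  open import Defs using (allVecs; countBy)

  χ : ∀ {a} {P : Set a} → Dec P → ℕ
  χ d = if does d then 1 else 0

  χ-yes : ∀ {a} {P : Set a} (d : Dec P) → P → χ d ≡ 1
  χ-yes (yes _) _ = refl
  χ-yes (no ¬p) p = ⊥-elim (¬p p)

  χ-no : ∀ {a} {P : Set a} (d : Dec P) → ¬ P → χ d ≡ 0
  χ-no (yes p) ¬p = ⊥-elim (¬p p)
  χ-no (no _) _ = refl

  χ≤1 : ∀ {a} {P : Set a} (d : Dec P) → χ d ≤ 1
  χ≤1 (yes _) = s≤s z≤n
  χ≤1 (no _) = z≤n

  χ-⇔ : ∀ {a b} {P : Set a} {Q : Set b} → (P → Q) → (Q → P) → (p : Dec P) (q : Dec Q) → χ p ≡ χ q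
  χ-⇔ f g (yes p) q = sym (χ-yes q (f p))
  χ-⇔ f g (no ¬p) q = sym (χ-no q (¬p ∘ g))

  χ-⊎ : ∀ {C A B : Set} (c : Dec C) (a : Dec A) (b : Dec B) → (C → A ⊎ B) → (A → C) → (B → C)
      → χ c ≡ χ b + χ a * (1 ∸ χ b)
  χ-⊎ c a (yes b) _ _ B→C = trans (χ-yes c (B→C b)) (cong suc (sym (*-zeroʳ (χ a))))
  χ-⊎ c (yes a) (no _) _ A→C _ = χ-yes c (A→C a)
  χ-⊎ c (no ¬a) (no ¬b) C→A⊎B _ _ = χ-no c ([ ¬a , ¬b ] ∘ C→A⊎B)

  χ[≟]-* : ∀ a k (g : ℕ → ℕ) → χ (a ≟ k) * g a ≡ χ (a ≟ k) * g k
  χ[≟]-* a k g = go (a ≟ k)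
    where
    go : (d : Dec (a ≡ k)) → χ d * g a ≡ χ d * g k
    go (yes refl) = refl
    go (no _) = refl

  ΣL : ∀ {A : Set} → List A → (A → ℕ) → ℕ
  ΣL [] f = 0
  ΣL (x ∷ xs) f = f x + ΣL xs f

  countBy≡ΣL : ∀ {A : Set} {P : A → Set} (P? : ∀ x → Dec (P x)) xs → countBy P? xs ≡ ΣL xs (χ ∘ P?)
  countBy≡ΣL P? [] = refl
  countBy≡ΣL P? (x ∷ xs) with does (P? x)
  ... | true = cong suc (countBy≡ΣL P? xs)
  ... | false = countBy≡ΣL P? xs

  ΣL-cong : ∀ {A : Set} (xs : List A) {f g : A → ℕ} → (∀ x → f x ≡ g x) → ΣL xs f ≡ ΣL xs g
  ΣL-cong [] _ = refl
  ΣL-cong (x ∷ xs) f≡g = cong₂ _+_ (f≡g x) (ΣL-cong xs f≡g)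

  ΣL-linear : ∀ {A : Set} (xs : List A) a b f g → ΣL xs (λ x → a * f x + b * g x) ≡ a * ΣL xs f + b * ΣL xs g
  ΣL-linear [] a b f g = solve 2 (λ a b → con 0 := a :* con 0 :+ b :* con 0) refl a b
  ΣL-linear (x ∷ xs) a b f g = trans (cong (a * f x + b * g x +_) (ΣL-linear xs a b f g))
    (solve 6 (λ a b u v F G → a :* u :+ b :* v :+ (a :* F :+ b :* G) := a :* (u :+ F) :+ b :* (v :+ G))
           refl a b (f x) (g x) (ΣL xs f) (ΣL xs g))

  ΣL-++ : ∀ {A : Set} (xs ys : List A) f → ΣL (xs ++ ys) f ≡ ΣL xs f + ΣL ys f
  ΣL-++ [] ys f = refl
  ΣL-++ (x ∷ xs) ys f = trans (cong (f x +_) (ΣL-++ xs ys f)) (sym (+-assoc (f x) _ _))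

  ΣL-concatMap : ∀ {A B : Set} (g : A → List B) xs f → ΣL (concatMap g xs) f ≡ ΣL xs (λ x → ΣL (g x) f)
  ΣL-concatMap g [] f = refl
  ΣL-concatMap g (x ∷ xs) f = trans (ΣL-++ (g x) (concatMap g xs) f) (cong (ΣL (g x) f +_) (ΣL-concatMap g xs f))

  ΣL-tabulate : ∀ {A : Set} n (g : Fin n → A) f → ΣL (tabulate g) f ≡ ∑[ i < n ] f (g i)
  ΣL-tabulate zero g f = refl
  ΣL-tabulate (suc n) g f = cong (f (g zero) +_) (ΣL-tabulate n (g ∘ suc) f)

  ΣL-allVecs : ∀ q L f → ΣL (allVecs q (suc L)) f ≡ ΣL (allVecs q L) (λ v → ∑[ x < q ] f (x ∷ v))
  ΣL-allVecs q L f = trans (ΣL-concatMap (λ v → map (_∷ v) (allFin q)) (allVecs q L) f)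
    (ΣL-cong (allVecs q L) (λ v → trans (cong (λ xs → ΣL xs f) (map-tabulate (λ x → x) (_∷ v)))
                                        (ΣL-tabulate q (_∷ v) f)))

  ∑<-shift-periodic : ∀ M (H : ℕ → ℕ) → (∀ e → H (M + e) ≡ H e) → ∀ c → ∑< M (λ e → H (e + c)) ≡ ∑< M H
  ∑<-shift-periodic M H periodic zero = ∑<-cong M (λ e _ → cong H (+-identityʳ e))
  ∑<-shift-periodic M H periodic (suc c) = trans (+-cancelʳ-≡ (H c) _ _ (begin
    ∑< M (λ e → H (e + suc c)) + H c      ≡⟨ +-comm _ (H c) ⟩
    H c + ∑< M (λ e → H (e + suc c))      ≡⟨ cong (H c +_) (∑<-cong M (λ e _ → cong H (+-suc e c))) ⟩
    ∑< (suc M) (λ e → H (e + c))          ≡⟨ ∑<-last M (λ e → H (e + c)) ⟩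
    ∑< M (λ e → H (e + c)) + H (M + c)    ≡⟨ cong (∑< M (λ e → H (e + c)) +_) (periodic c) ⟩
    ∑< M (λ e → H (e + c)) + H c          ∎))
    (∑<-shift-periodic M H periodic c)

  ∑<-periodic : ∀ w M (H : ℕ → ℕ) → (∀ e → H (M + e) ≡ H e) → ∑< (w * M) H ≡ w * ∑< M H
  ∑<-periodic zero M H periodic = refl
  ∑<-periodic (suc w) M H periodic = begin
    ∑< (M + w * M) H                          ≡⟨ ∑<-split M (w * M) H ⟩
    ∑< M H + ∑< (w * M) (λ e → H (M + e))     ≡⟨ cong (∑< M H +_) (∑<-cong (w * M) (λ e _ → periodic e)) ⟩
    ∑< M H + ∑< (w * M) H                     ≡⟨ cong (∑< M H +_) (∑<-periodic w M H periodic) ⟩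
    ∑< M H + w * ∑< M H                       ∎

  ∑<-mod : ∀ w M .{{_ : NonZero M}} c (G : ℕ → ℕ) → ∑< (w * M) (λ e → G ((e + c) % M)) ≡ w * ∑< M G
  ∑<-mod w M c G = begin
    ∑< (w * M) (λ e → G ((e + c) % M))  ≡⟨ ∑<-periodic w M (λ e → G ((e + c) % M)) (λ e → cong G (shift-mod (e + c) (+-assoc M e c))) ⟩
    w * ∑< M (λ e → G ((e + c) % M))    ≡⟨ cong (w *_) (∑<-shift-periodic M (λ e → G (e % M)) (λ e → cong G (shift-mod e refl)) c) ⟩
    w * ∑< M (λ e → G (e % M))          ≡⟨ cong (w *_) (∑<-cong M (λ e e<M → cong G (m<n⇒m%n≡m e<M))) ⟩
    w * ∑< M G                          ∎
    where
    shift-mod : ∀ e {n} → n ≡ M + e → n % M ≡ e % M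
    shift-mod e refl = trans (cong (_% M) (+-comm M e)) ([m+n]%n≡m%n e M)

  ∑<-complement : ∀ n (b : ℕ → ℕ) → (∀ l → b l ≤ 1) → ∑< n (λ l → 1 ∸ b l) + ∑< n b ≡ n
  ∑<-complement zero b b≤1 = refl
  ∑<-complement (suc n) b b≤1 = begin
    (1 ∸ b 0) + X + (b 0 + Y) ≡⟨ solve 4 (λ a x b y → a :+ x :+ (b :+ y) := (a :+ b) :+ (x :+ y)) refl (1 ∸ b 0) X (b 0) Y ⟩
    (1 ∸ b 0 + b 0) + (X + Y) ≡⟨ cong₂ _+_ (m∸n+n≡m (b≤1 0)) (∑<-complement n (b ∘ suc) (b≤1 ∘ suc)) ⟩
    suc n                     ∎
    where
    X = ∑< n (λ j → 1 ∸ b (suc j))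
    Y = ∑< n (b ∘ suc)

  -- The number of words of length L over 1 + m w letters (one unlabelled letter, w letters for each of m labels)
  -- that use exactly k labels: appending a letter keeps the label count or adds one of the m ∸ k unused labels.
  exactHits : (m w : ℕ) → ℕ → ℕ → ℕ
  exactHits m w zero    zero    = 1
  exactHits m w zero    (suc k) = 0
  exactHits m w (suc L) zero    = exactHits m w L zero
  exactHits m w (suc L) (suc k) = (1 + w * suc k) * exactHits m w L (suc k) + (w * (m ∸ k)) * exactHits m w L k

  module Hits (q m w : ℕ) where

    Labelling : ℕ → Set
    Labelling L = Fin L → Fin q → Maybe ℕ

    HitBy : ∀ {L} → Labelling L → Vec (Fin q) L → ℕ → Set
    HitBy lab c l = ∃ λ i → lab i (lookup c i) ≡ just l

    hit? : ∀ {L} (lab : Labelling L) c l → Dec (HitBy lab c l)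
    hit? lab c l = any? (λ i → ≡-dec _≟_ (lab i (lookup c i)) (just l))

    hits : ∀ {L} → Labelling L → Vec (Fin q) L → ℕ
    hits lab c = ∑< m (λ l → χ (hit? lab c l))

    -- Exactly one letter is unlabelled and each of the m labels is carried by exactly w letters.
    UniformFibres : ∀ {L} → Labelling L → Set
    UniformFibres {L} lab = ∀ i (Q : Maybe ℕ → ℕ) → ∑[ x < q ] Q (lab i x) ≡ Q nothing + w * ∑< m (Q ∘ just)

    LabelsBelow : ∀ {L} → Labelling L → Set
    LabelsBelow {L} lab = ∀ i x l → lab i x ≡ just l → l < m

    stepWeight : ℕ → ℕ → ℕ
    stepWeight k a = χ (a ≟ k) * (1 + w * a) + χ (suc a ≟ k) * (w * (m ∸ a))

    stepWeight-zero : ∀ a → stepWeight 0 a ≡ χ (a ≟ 0)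
    stepWeight-zero a = trans (+-identityʳ _) (trans (χ[≟]-* a 0 (λ a → 1 + w * a))
      (trans (cong (χ (a ≟ 0) *_) (cong suc (*-zeroʳ w))) (*-identityʳ _)))

    stepWeight-suc : ∀ k a → stepWeight (suc k) a ≡ (1 + w * suc k) * χ (a ≟ suc k) + (w * (m ∸ k)) * χ (a ≟ k)
    stepWeight-suc k a = begin
      χ (a ≟ suc k) * (1 + w * a) + χ (a ≟ k) * (w * (m ∸ a))
        ≡⟨ cong₂ _+_ (χ[≟]-* a (suc k) (λ a → 1 + w * a)) (χ[≟]-* a k (λ a → w * (m ∸ a))) ⟩
      χ (a ≟ suc k) * (1 + w * suc k) + χ (a ≟ k) * (w * (m ∸ k))
        ≡⟨ cong₂ _+_ (*-comm (χ (a ≟ suc k)) _) (*-comm (χ (a ≟ k)) _) ⟩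
      (1 + w * suc k) * χ (a ≟ suc k) + (w * (m ∸ k)) * χ (a ≟ k) ∎

    newHit : ∀ {L} → Labelling L → Vec (Fin q) L → Maybe ℕ → ℕ
    newHit lab v nothing = 0
    newHit lab v (just l) = 1 ∸ χ (hit? lab v l)

    ∑<-χ-just : ∀ (u : Maybe ℕ) (g : ℕ → ℕ) → (∀ l → u ≡ just l → l < m) →
                ∑< m (λ l → χ (≡-dec _≟_ u (just l)) * g l) ≡ maybe g 0 u
    ∑<-χ-just nothing g _ = ∑<-zero m
    ∑<-χ-just (just l₀) g bound = go m l₀ g (bound l₀ refl)
      where
      go : ∀ n l₀ (g : ℕ → ℕ) → l₀ < n → ∑< n (λ l → χ (≡-dec _≟_ (just l₀) (just l)) * g l) ≡ g l₀
      go (suc n) zero g _ = trans (cong (g 0 + 0 +_) (∑<-zero n)) (trans (+-identityʳ _) (+-identityʳ _))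
      go (suc n) (suc l₀) g (s≤s l₀<n) = go n l₀ (g ∘ suc) l₀<n

    hits-∷ : ∀ {L} (lab : Labelling (suc L)) x v → (∀ l → lab zero x ≡ just l → l < m) →
             hits lab (x ∷ v) ≡ hits (lab ∘ suc) v + newHit (lab ∘ suc) v (lab zero x)
    hits-∷ {L} lab x v bound = begin
      ∑< m (λ l → χ (hit? lab (x ∷ v) l))
        ≡⟨ ∑<-cong m (λ l _ → χ-⊎ (hit? lab (x ∷ v) l) (head? l) (hit? lab′ v l) split (zero ,_) (λ (i , p) → suc i , p)) ⟩
      ∑< m (λ l → χ (hit? lab′ v l) + χ (head? l) * (1 ∸ χ (hit? lab′ v l)))
        ≡⟨ ∑<-distrib-+ m (λ l → χ (hit? lab′ v l)) (λ l → χ (head? l) * (1 ∸ χ (hit? lab′ v l))) ⟩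
      hits lab′ v + ∑< m (λ l → χ (head? l) * (1 ∸ χ (hit? lab′ v l)))
        ≡⟨ cong (hits lab′ v +_) (trans (∑<-χ-just (lab zero x) _ bound) (maybe-newHit (lab zero x))) ⟩
      hits lab′ v + newHit lab′ v (lab zero x) ∎
      where
      lab′ = lab ∘ suc
      head? : ∀ l → Dec (lab zero x ≡ just l)
      head? l = ≡-dec _≟_ (lab zero x) (just l)
      split : ∀ {l} → HitBy lab (x ∷ v) l → lab zero x ≡ just l ⊎ HitBy lab′ v l
      split (zero , p) = inj₁ p
      split (suc i , p) = inj₂ (i , p)
      maybe-newHit : ∀ u → maybe (λ l → 1 ∸ χ (hit? lab′ v l)) 0 u ≡ newHit lab′ v u
      maybe-newHit nothing = refl
      maybe-newHit (just l) = refl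

    ∑-χ-hits-∷ : ∀ {L} (lab : Labelling (suc L)) → UniformFibres lab → LabelsBelow lab → ∀ k v →
                 ∑[ x < q ] χ (hits lab (x ∷ v) ≟ k) ≡ stepWeight k (hits (lab ∘ suc) v)
    ∑-χ-hits-∷ {L} lab uniform bound k v = begin
      ∑[ x < q ] χ (hits lab (x ∷ v) ≟ k)
        ≡⟨ sum-cong-≗ {q} (λ x → cong (λ n → χ (n ≟ k)) (hits-∷ lab x v (bound zero x))) ⟩
      ∑[ x < q ] Q (lab zero x)
        ≡⟨ uniform zero Q ⟩
      χ (a + 0 ≟ k) + w * ∑< m (λ l → χ (a + (1 ∸ b l) ≟ k))
        ≡⟨ cong₂ (λ n s → χ (n ≟ k) + w * s) (+-identityʳ a) new-label-sum ⟩
      χ (a ≟ k) + w * (χ (a ≟ k) * a + χ (suc a ≟ k) * (m ∸ a))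
        ≡⟨ solve 5 (λ χ₀ w a χ₁ d → χ₀ :+ w :* (χ₀ :* a :+ χ₁ :* d) := χ₀ :* (con 1 :+ w :* a) :+ χ₁ :* (w :* d))
                 refl (χ (a ≟ k)) w a (χ (suc a ≟ k)) (m ∸ a) ⟩
      stepWeight k a ∎
      where
      lab′ = lab ∘ suc
      a = hits lab′ v
      Q : Maybe ℕ → ℕ
      Q u = χ (a + newHit lab′ v u ≟ k)
      b : ℕ → ℕ
      b l = χ (hit? lab′ v l)
      by-hit : ∀ l → χ (a + (1 ∸ b l) ≟ k) ≡ χ (a ≟ k) * b l + χ (suc a ≟ k) * (1 ∸ b l)
      by-hit l with hit? lab′ v l
      ... | yes _ = trans (cong (λ n → χ (n ≟ k)) (+-identityʳ a))
                          (solve 2 (λ x y → x := x :* con 1 :+ y :* con 0) refl (χ (a ≟ k)) (χ (suc a ≟ k)))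
      ... | no _ = trans (cong (λ n → χ (n ≟ k)) (+-comm a 1))
                         (solve 2 (λ x y → y := x :* con 0 :+ y :* con 1) refl (χ (a ≟ k)) (χ (suc a ≟ k)))
      misses : ∑< m (λ l → 1 ∸ b l) ≡ m ∸ a
      misses = trans (sym (m+n∸n≡m _ a)) (cong (_∸ a) (∑<-complement m b (λ l → χ≤1 (hit? lab′ v l))))
      new-label-sum : ∑< m (λ l → χ (a + (1 ∸ b l) ≟ k)) ≡ χ (a ≟ k) * a + χ (suc a ≟ k) * (m ∸ a)
      new-label-sum = begin
        ∑< m (λ l → χ (a + (1 ∸ b l) ≟ k))
          ≡⟨ ∑<-cong m (λ l _ → by-hit l) ⟩
        ∑< m (λ l → χ (a ≟ k) * b l + χ (suc a ≟ k) * (1 ∸ b l))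
          ≡⟨ ∑<-distrib-+ m (λ l → χ (a ≟ k) * b l) (λ l → χ (suc a ≟ k) * (1 ∸ b l)) ⟩
        ∑< m (λ l → χ (a ≟ k) * b l) + ∑< m (λ l → χ (suc a ≟ k) * (1 ∸ b l))
          ≡⟨ sym (cong₂ _+_ (*-distribˡ-∑< m (χ (a ≟ k)) b) (*-distribˡ-∑< m (χ (suc a ≟ k)) (λ l → 1 ∸ b l))) ⟩
        χ (a ≟ k) * a + χ (suc a ≟ k) * ∑< m (λ l → 1 ∸ b l)
          ≡⟨ cong (λ n → χ (a ≟ k) * a + χ (suc a ≟ k) * n) misses ⟩
        χ (a ≟ k) * a + χ (suc a ≟ k) * (m ∸ a) ∎

    count-hits≡exactHits : ∀ L (lab : Labelling L) → UniformFibres lab → LabelsBelow lab → ∀ k →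
                           ΣL (allVecs q L) (λ c → χ (hits lab c ≟ k)) ≡ exactHits m w L k
    count-hits≡exactHits zero lab _ _ zero = cong (λ n → χ (n ≟ 0) + 0) (∑<-zero m)
    count-hits≡exactHits zero lab _ _ (suc k) = cong (λ n → χ (n ≟ suc k) + 0) (∑<-zero m)
    count-hits≡exactHits (suc L) lab uniform bound k = begin
      ΣL (allVecs q (suc L)) (λ c → χ (hits lab c ≟ k))
        ≡⟨ ΣL-allVecs q L (λ c → χ (hits lab c ≟ k)) ⟩
      ΣL (allVecs q L) (λ v → ∑[ x < q ] χ (hits lab (x ∷ v) ≟ k))
        ≡⟨ ΣL-cong (allVecs q L) (∑-χ-hits-∷ lab uniform bound k) ⟩
      ΣL (allVecs q L) (λ v → stepWeight k (hits (lab ∘ suc) v))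
        ≡⟨ by-target k ⟩
      exactHits m w (suc L) k ∎
      where
      IH = count-hits≡exactHits L (lab ∘ suc) (uniform ∘ suc) (bound ∘ suc)
      count : ℕ → ℕ
      count k = ΣL (allVecs q L) (λ v → χ (hits (lab ∘ suc) v ≟ k))
      by-target : ∀ k → ΣL (allVecs q L) (λ v → stepWeight k (hits (lab ∘ suc) v)) ≡ exactHits m w (suc L) k
      by-target zero = trans (ΣL-cong (allVecs q L) (λ v → stepWeight-zero (hits (lab ∘ suc) v))) (IH zero)
      by-target (suc k) = begin
        ΣL (allVecs q L) (λ v → stepWeight (suc k) (hits (lab ∘ suc) v))
          ≡⟨ ΣL-cong (allVecs q L) (λ v → stepWeight-suc k (hits (lab ∘ suc) v)) ⟩
        ΣL (allVecs q L) (λ v → (1 + w * suc k) * χ (hits (lab ∘ suc) v ≟ suc k) + (w * (m ∸ k)) * χ (hits (lab ∘ suc) v ≟ k))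
          ≡⟨ ΣL-linear (allVecs q L) (1 + w * suc k) (w * (m ∸ k)) _ _ ⟩
        (1 + w * suc k) * count (suc k) + (w * (m ∸ k)) * count k
          ≡⟨ cong₂ (λ x y → (1 + w * suc k) * x + (w * (m ∸ k)) * y) (IH (suc k)) (IH k) ⟩
        exactHits m w (suc L) (suc k) ∎

module ClosedForm where

  open import Algebra.Bundles using (Ring)
  open import Data.Nat as ℕ using (ℕ; zero; suc; _∸_; _<_; _≤_; s≤s)
  import Data.Nat.Properties as ℕP
  open import Data.Nat.Combinatorics using (_C_; nCk+nC[k+1]≡[n+1]C[k+1]; k>n⇒nCk≡0)
  open import Data.Integer as ℤ using (ℤ)
  import Data.Integer.Properties as ℤP
  open import Data.Rational as ℚ using (ℚ; _+_; _*_; -_; _-_; 0ℚ; 1ℚ)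
  import Data.Rational.Properties as ℚP
  import Data.Rational.Unnormalised as ℚᵘ
  import Data.Rational.Unnormalised.Properties as ℚᵘP
  open import Data.Rational.Solver using (module +-*-Solver)
  open +-*-Solver
  open import Relation.Binary.PropositionalEquality
  open import Relation.Nullary using (yes; no)
  open ≡-Reasoning
  open import Defs using (_^ℚ_; _/ℚ_; sumTo; rhs)
  open import Data.List using (foldr; map; applyUpTo)
  open Binomial
  open Counting using (exactHits)
  open IndexedSum (Ring.semiring ℚP.+-*-ring)

  ι : ℕ → ℚ
  ι n = ℤ.+ n ℚ./ 1

  private
    toℚᵘ-ι : ∀ n → ℚ.toℚᵘ (ι n) ℚᵘ.≃ ℚᵘ.mkℚᵘ (ℤ.+ n) 0
    toℚᵘ-ι n = ℚP.toℚᵘ-fromℚᵘ (ℚᵘ.mkℚᵘ (ℤ.+ n) 0)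

  ι-homo-+ : ∀ a b → ι (a ℕ.+ b) ≡ ι a + ι b
  ι-homo-+ a b = ℚP.toℚᵘ-injective (ℚᵘP.≃-trans (toℚᵘ-ι (a ℕ.+ b))
    (ℚᵘP.≃-trans sum≃ (ℚᵘP.≃-sym (ℚᵘP.≃-trans (ℚP.toℚᵘ-homo-+ (ι a) (ι b)) (ℚᵘP.+-cong (toℚᵘ-ι a) (toℚᵘ-ι b))))))
    where
    sum≃ : ℚᵘ.mkℚᵘ (ℤ.+ (a ℕ.+ b)) 0 ℚᵘ.≃ (ℚᵘ.mkℚᵘ (ℤ.+ a) 0 ℚᵘ.+ ℚᵘ.mkℚᵘ (ℤ.+ b) 0)
    sum≃ = ℚᵘ.*≡* (cong (ℤ._* ℤ.+ 1) (trans (ℤP.pos-+ a b)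
             (sym (cong₂ ℤ._+_ (ℤP.*-identityʳ (ℤ.+ a)) (ℤP.*-identityʳ (ℤ.+ b))))))

  ι-homo-* : ∀ a b → ι (a ℕ.* b) ≡ ι a * ι b
  ι-homo-* a b = ℚP.toℚᵘ-injective (ℚᵘP.≃-trans (toℚᵘ-ι (a ℕ.* b))
    (ℚᵘP.≃-trans (ℚᵘ.*≡* (cong (ℤ._* ℤ.+ 1) (ℤP.pos-* a b)))
    (ℚᵘP.≃-sym (ℚᵘP.≃-trans (ℚP.toℚᵘ-homo-* (ι a) (ι b)) (ℚᵘP.*-cong (toℚᵘ-ι a) (toℚᵘ-ι b))))))

  ι-homo-^ : ∀ a n → ι (a ℕ.^ n) ≡ ι a ^ℚ n
  ι-homo-^ a zero = refl
  ι-homo-^ a (suc n) = trans (ι-homo-* a (a ℕ.^ n)) (cong (ι a *_) (ι-homo-^ a n))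

  [z/n]*n≡z : ∀ (z : ℤ) n .{{_ : ℕ.NonZero n}} → (z ℚ./ n) * ι n ≡ z ℚ./ 1
  [z/n]*n≡z z n@(suc d) = ℚP.toℚᵘ-injective (ℚᵘP.≃-trans (ℚP.toℚᵘ-homo-* (z ℚ./ n) (ι n))
    (ℚᵘP.≃-trans (ℚᵘP.*-cong (ℚP.toℚᵘ-fromℚᵘ (ℚᵘ.mkℚᵘ z d)) (toℚᵘ-ι n))
    (ℚᵘP.≃-trans quot≃ (ℚᵘP.≃-sym (ℚP.toℚᵘ-fromℚᵘ (ℚᵘ.mkℚᵘ z 0))))))
    where
    quot≃ : (ℚᵘ.mkℚᵘ z d ℚᵘ.* ℚᵘ.mkℚᵘ (ℤ.+ n) 0) ℚᵘ.≃ ℚᵘ.mkℚᵘ z 0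
    quot≃ = ℚᵘ.*≡* (trans (ℤP.*-identityʳ _) (cong (λ x → z ℤ.* ℤ.+ x) (sym (ℕP.*-identityʳ n))))

  *-cancelʳ-ι : ∀ x y n .{{_ : ℕ.NonZero n}} → x * ι n ≡ y * ι n → x ≡ y
  *-cancelʳ-ι x y n eq = begin
    x               ≡⟨ sym (ℚP.*-identityʳ x) ⟩
    x * 1ℚ          ≡⟨ cong (x *_) (sym n*u≡1) ⟩
    x * (ι n * u)   ≡⟨ sym (ℚP.*-assoc x (ι n) u) ⟩
    x * ι n * u     ≡⟨ cong (_* u) eq ⟩
    y * ι n * u     ≡⟨ ℚP.*-assoc y (ι n) u ⟩
    y * (ι n * u)   ≡⟨ cong (y *_) n*u≡1 ⟩
    y * 1ℚ          ≡⟨ ℚP.*-identityʳ y ⟩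
    y               ∎
    where
    u = ℤ.+ 1 ℚ./ n
    n*u≡1 : ι n * u ≡ 1ℚ
    n*u≡1 = trans (ℚP.*-comm (ι n) u) ([z/n]*n≡z (ℤ.+ 1) n)

  ^ℚ-distrib-* : ∀ a b n → (a * b) ^ℚ n ≡ (a ^ℚ n) * (b ^ℚ n)
  ^ℚ-distrib-* a b zero = refl
  ^ℚ-distrib-* a b (suc n) = trans (cong ((a * b) *_) (^ℚ-distrib-* a b n))
    (solve 4 (λ a b x y → (a :* b) :* (x :* y) := (a :* x) :* (b :* y)) refl a b (a ^ℚ n) (b ^ℚ n))

  1^ℚn≡1 : ∀ n → 1ℚ ^ℚ n ≡ 1ℚ
  1^ℚn≡1 zero = refl
  1^ℚn≡1 (suc n) = trans (ℚP.*-identityˡ _) (1^ℚn≡1 n)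

  signedC : ℕ → ℕ → ℚ
  signedC k j = (- 1ℚ) ^ℚ (k ∸ j) * ι (k C j)

  Δ : ℕ → (ℕ → ℚ) → ℚ
  Δ k h = ∑< (suc k) (λ j → signedC k j * h j)

  Δ-cong : ∀ k {f g} → (∀ j → j ≤ k → f j ≡ g j) → Δ k f ≡ Δ k g
  Δ-cong k f≡g = ∑<-cong (suc k) (λ j j<1+k → cong (signedC k j *_) (f≡g j (ℕP.≤-pred j<1+k)))

  Δ-distrib-+ : ∀ k f g → Δ k (λ j → f j + g j) ≡ Δ k f + Δ k g
  Δ-distrib-+ k f g = trans (∑<-cong (suc k) (λ j _ → ℚP.*-distribˡ-+ (signedC k j) (f j) (g j)))
    (∑<-distrib-+ (suc k) (λ j → signedC k j * f j) (λ j → signedC k j * g j))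

  *-distribˡ-Δ : ∀ k c f → c * Δ k f ≡ Δ k (λ j → c * f j)
  *-distribˡ-Δ k c f = trans (*-distribˡ-∑< (suc k) c (λ j → signedC k j * f j))
    (∑<-cong (suc k) {λ j → c * (signedC k j * f j)} (λ j _ → solve 3 (λ c s x → c :* (s :* x) := s :* (c :* x)) refl c (signedC k j) (f j)))

  private
    signedC-shift : ∀ k j → (- 1ℚ) ^ℚ (k ∸ j) * ι (k C suc j) ≡ - signedC k (suc j)
    signedC-shift k j with j ℕ.<? k
    ... | yes j<k = begin
      (- 1ℚ) ^ℚ (k ∸ j) * c              ≡⟨ cong (λ n → (- 1ℚ) ^ℚ n * c) (ℕP.+-∸-assoc 1 j<k) ⟩
      (- 1ℚ) * (- 1ℚ) ^ℚ (k ∸ suc j) * c ≡⟨ solve 2 (λ σ c → (:- con 1ℚ) :* σ :* c := :- (σ :* c)) refl ((- 1ℚ) ^ℚ (k ∸ suc j)) c ⟩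
      - signedC k (suc j)                ∎
      where c = ι (k C suc j)
    ... | no j≮k = begin
      (- 1ℚ) ^ℚ (k ∸ j) * ι (k C suc j)  ≡⟨ cong (λ n → (- 1ℚ) ^ℚ (k ∸ j) * ι n) C≡0 ⟩
      (- 1ℚ) ^ℚ (k ∸ j) * 0ℚ             ≡⟨ solve 2 (λ σ τ → σ :* con 0ℚ := :- (τ :* con 0ℚ)) refl ((- 1ℚ) ^ℚ (k ∸ j)) ((- 1ℚ) ^ℚ (k ∸ suc j)) ⟩
      - ((- 1ℚ) ^ℚ (k ∸ suc j) * 0ℚ)     ≡⟨ cong (λ n → - ((- 1ℚ) ^ℚ (k ∸ suc j) * ι n)) (sym C≡0) ⟩
      - signedC k (suc j)                ∎
      where
      C≡0 : k C suc j ≡ 0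
      C≡0 = k>n⇒nCk≡0 (s≤s (ℕP.≮⇒≥ j≮k))

  signedC-pascal : ∀ k j → signedC (suc k) (suc j) ≡ signedC k j - signedC k (suc j)
  signedC-pascal k j = begin
    σ * ι (suc k C suc j)              ≡⟨ cong (λ n → σ * ι n) (sym (nCk+nC[k+1]≡[n+1]C[k+1] k j)) ⟩
    σ * ι (k C j ℕ.+ k C suc j)        ≡⟨ cong (σ *_) (ι-homo-+ (k C j) (k C suc j)) ⟩
    σ * (ι (k C j) + ι (k C suc j))    ≡⟨ ℚP.*-distribˡ-+ σ _ _ ⟩
    signedC k j + σ * ι (k C suc j)    ≡⟨ cong (signedC k j +_) (signedC-shift k j) ⟩
    signedC k j - signedC k (suc j)    ∎
    where σ = (- 1ℚ) ^ℚ (k ∸ j)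

  signedC-vanish : ∀ k j → k < j → signedC k j ≡ 0ℚ
  signedC-vanish k j k<j = trans (cong (λ n → (- 1ℚ) ^ℚ (k ∸ j) * ι n) (k>n⇒nCk≡0 k<j)) (ℚP.*-zeroʳ ((- 1ℚ) ^ℚ (k ∸ j)))

  signedC-absorb : ∀ k j → j ≤ k → signedC (suc k) j * ι (suc k ∸ j) ≡ - ι (suc k) * signedC k j
  signedC-absorb k j j≤k = begin
    (- 1ℚ) ^ℚ (suc k ∸ j) * ι (suc k C j) * ι (suc k ∸ j)
      ≡⟨ trans (ℚP.*-assoc ((- 1ℚ) ^ℚ (suc k ∸ j)) (ι (suc k C j)) (ι (suc k ∸ j))) (cong ((- 1ℚ) ^ℚ (suc k ∸ j) *_) (sym (ι-homo-* (suc k C j) (suc k ∸ j)))) ⟩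
    (- 1ℚ) ^ℚ (suc k ∸ j) * ι ((suc k C j) ℕ.* (suc k ∸ j))
      ≡⟨ cong₂ (λ n m → (- 1ℚ) ^ℚ n * ι m) (ℕP.+-∸-assoc 1 j≤k) ([1+n]Ck*[1+n∸k]≡[1+n]*nCk k j) ⟩
    (- 1ℚ) * σ * ι (suc k ℕ.* (k C j))
      ≡⟨ cong ((- 1ℚ) * σ *_) (ι-homo-* (suc k) (k C j)) ⟩
    (- 1ℚ) * σ * (ι (suc k) * ι (k C j))
      ≡⟨ solve 3 (λ σ n c → (:- con 1ℚ) :* σ :* (n :* c) := (:- n) :* (σ :* c)) refl σ (ι (suc k)) (ι (k C j)) ⟩
    - ι (suc k) * signedC k j ∎
    where σ = (- 1ℚ) ^ℚ (k ∸ j)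

  Δ-suc : ∀ k h → Δ (suc k) h ≡ Δ k (λ j → h (suc j)) - Δ k h
  Δ-suc k h = begin
    c₀ + ∑< (suc k) (λ j → signedC (suc k) (suc j) * h (suc j))
      ≡⟨ cong (c₀ +_) (∑<-cong (suc k) (λ j _ → pascal j)) ⟩
    c₀ + ∑< (suc k) (λ j → a j + (- 1ℚ) * b j)
      ≡⟨ cong (c₀ +_) (∑<-distrib-+ (suc k) a (λ j → (- 1ℚ) * b j)) ⟩
    c₀ + (D + ∑< (suc k) (λ j → (- 1ℚ) * b j))
      ≡⟨ cong (λ x → c₀ + (D + x)) (sym (*-distribˡ-∑< (suc k) (- 1ℚ) b)) ⟩
    c₀ + (D + (- 1ℚ) * ∑< (suc k) b)
      ≡⟨ cong (λ x → c₀ + (D + (- 1ℚ) * x)) (trans (∑<-last k b) (cong (∑< k b +_) b[k]≡0)) ⟩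
    c₀ + (D + (- 1ℚ) * (∑< k b + 0ℚ))
      ≡⟨ solve 5 (λ σ c h D B → (:- con 1ℚ) :* σ :* c :* h :+ (D :+ (:- con 1ℚ) :* (B :+ con 0ℚ))
                               := D :- (σ :* c :* h :+ B)) refl ((- 1ℚ) ^ℚ k) (ι 1) (h 0) D (∑< k b) ⟩
    D - Δ k h ∎
    where
    c₀ = signedC (suc k) 0 * h 0
    a b : ℕ → ℚ
    a j = signedC k j * h (suc j)
    b j = signedC k (suc j) * h (suc j)
    D = Δ k (λ j → h (suc j))
    pascal : ∀ j → signedC (suc k) (suc j) * h (suc j) ≡ a j + (- 1ℚ) * b j
    pascal j = trans (cong (_* h (suc j)) (signedC-pascal k j))
      (solve 3 (λ x y z → (x :- y) :* z := x :* z :+ (:- con 1ℚ) :* (y :* z)) refl (signedC k j) (signedC k (suc j)) (h (suc j)))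
    b[k]≡0 : b k ≡ 0ℚ
    b[k]≡0 = trans (cong (_* h (suc k)) (signedC-vanish k (suc k) (ℕP.n<1+n k))) (ℚP.*-zeroˡ (h (suc k)))

  Δ-const : ∀ k c → Δ (suc k) (λ _ → c) ≡ 0ℚ
  Δ-const k c = trans (Δ-suc k (λ _ → c)) (ℚP.+-inverseʳ (Δ k (λ _ → c)))

  Δ-absorb : ∀ k h → Δ (suc k) (λ j → ι (suc k ∸ j) * h j) ≡ - ι (suc k) * Δ k h
  Δ-absorb k h = begin
    ∑< (suc (suc k)) G                              ≡⟨ ∑<-last (suc k) G ⟩
    ∑< (suc k) G + G (suc k)                        ≡⟨ cong (∑< (suc k) G +_) G[1+k]≡0 ⟩
    ∑< (suc k) G + 0ℚ                               ≡⟨ ℚP.+-identityʳ _ ⟩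
    ∑< (suc k) G                                    ≡⟨ ∑<-cong (suc k) (λ j j<1+k → absorb j (ℕP.≤-pred j<1+k)) ⟩
    ∑< (suc k) (λ j → - ι (suc k) * (signedC k j * h j)) ≡⟨ sym (*-distribˡ-∑< (suc k) (- ι (suc k)) (λ j → signedC k j * h j)) ⟩
    - ι (suc k) * Δ k h                             ∎
    where
    G : ℕ → ℚ
    G j = signedC (suc k) j * (ι (suc k ∸ j) * h j)
    G[1+k]≡0 : G (suc k) ≡ 0ℚ
    G[1+k]≡0 = trans (cong (λ n → signedC (suc k) (suc k) * (ι n * h (suc k))) (ℕP.n∸n≡0 k))
      (solve 2 (λ c x → c :* (con 0ℚ :* x) := con 0ℚ) refl (signedC (suc k) (suc k)) (h (suc k)))
    absorb : ∀ j → j ≤ k → G j ≡ - ι (suc k) * (signedC k j * h j)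
    absorb j j≤k = trans (sym (ℚP.*-assoc (signedC (suc k) j) (ι (suc k ∸ j)) (h j)))
      (trans (cong (_* h j) (signedC-absorb k j j≤k)) (ℚP.*-assoc (- ι (suc k)) (signedC k j) (h j)))

  module _ (m w : ℕ) where

    private
      powers : ℕ → ℕ → ℚ
      powers L j = ι (1 ℕ.+ w ℕ.* j) ^ℚ L

      1+wj+w[K∸j]≡1+wK : ∀ K j → j ≤ K → ι (1 ℕ.+ w ℕ.* j) + ι w * ι (K ∸ j) ≡ ι (1 ℕ.+ w ℕ.* K)
      1+wj+w[K∸j]≡1+wK K j j≤K = begin
        ι (1 ℕ.+ w ℕ.* j) + ι w * ι (K ∸ j)     ≡⟨ cong (ι (1 ℕ.+ w ℕ.* j) +_) (sym (ι-homo-* w (K ∸ j))) ⟩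
        ι (1 ℕ.+ w ℕ.* j) + ι (w ℕ.* (K ∸ j))   ≡⟨ sym (ι-homo-+ (1 ℕ.+ w ℕ.* j) (w ℕ.* (K ∸ j))) ⟩
        ι (1 ℕ.+ w ℕ.* j ℕ.+ w ℕ.* (K ∸ j))     ≡⟨ cong ι (cong suc (trans (sym (ℕP.*-distribˡ-+ w j (K ∸ j))) (cong (w ℕ.*_) (ℕP.m+[n∸m]≡n j≤K)))) ⟩
        ι (1 ℕ.+ w ℕ.* K)                       ∎

      Δ-powers-suc : ∀ k L → Δ (suc k) (powers (suc L))
                   ≡ ι (1 ℕ.+ w ℕ.* suc k) * Δ (suc k) (powers L) + ι w * ι (suc k) * Δ k (powers L)
      Δ-powers-suc k L = begin
        Δ K (powers (suc L))
          ≡⟨ Δ-cong K split ⟩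
        Δ K (λ j → c * powers L j + (- ι w) * (ι (K ∸ j) * powers L j))
          ≡⟨ Δ-distrib-+ K (λ j → c * powers L j) (λ j → (- ι w) * (ι (K ∸ j) * powers L j)) ⟩
        Δ K (λ j → c * powers L j) + Δ K (λ j → (- ι w) * (ι (K ∸ j) * powers L j))
          ≡⟨ sym (cong₂ _+_ (*-distribˡ-Δ K c (powers L)) (*-distribˡ-Δ K (- ι w) (λ j → ι (K ∸ j) * powers L j))) ⟩
        c * Δ K (powers L) + (- ι w) * Δ K (λ j → ι (K ∸ j) * powers L j)
          ≡⟨ cong (λ x → c * Δ K (powers L) + (- ι w) * x) (Δ-absorb k (powers L)) ⟩
        c * Δ K (powers L) + (- ι w) * (- ι K * Δ k (powers L))
          ≡⟨ solve 5 (λ c x w K y → c :* x :+ (:- w) :* ((:- K) :* y) := c :* x :+ w :* K :* y) refl c (Δ K (powers L)) (ι w) (ι K) (Δ k (powers L)) ⟩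
        c * Δ K (powers L) + ι w * ι K * Δ k (powers L) ∎
        where
        K = suc k
        c = ι (1 ℕ.+ w ℕ.* K)
        split : ∀ j → j ≤ K → powers (suc L) j ≡ c * powers L j + (- ι w) * (ι (K ∸ j) * powers L j)
        split j j≤K = begin
          ι (1 ℕ.+ w ℕ.* j) * powers L j
            ≡⟨ solve 4 (λ a w d x → a :* x := (a :+ w :* d) :* x :+ (:- w) :* (d :* x)) refl (ι (1 ℕ.+ w ℕ.* j)) (ι w) (ι (K ∸ j)) (powers L j) ⟩
          (ι (1 ℕ.+ w ℕ.* j) + ι w * ι (K ∸ j)) * powers L j + (- ι w) * (ι (K ∸ j) * powers L j)
            ≡⟨ cong (λ a → a * powers L j + (- ι w) * (ι (K ∸ j) * powers L j)) (1+wj+w[K∸j]≡1+wK K j j≤K) ⟩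
          c * powers L j + (- ι w) * (ι (K ∸ j) * powers L j) ∎

    exactHits-closedForm : ∀ L k → ι (exactHits m w L k) ≡ ι (m C k) * Δ k (λ j → ι (1 ℕ.+ w ℕ.* j) ^ℚ L)
    exactHits-closedForm zero zero = refl
    exactHits-closedForm zero (suc k) = sym (trans (cong (ι (m C suc k) *_) (Δ-const k 1ℚ)) (ℚP.*-zeroʳ (ι (m C suc k))))
    exactHits-closedForm (suc L) zero = trans (exactHits-closedForm L zero)
      (cong (λ x → ι 1 * (ι 1 * x + 0ℚ)) (sym (trans (cong (λ n → ι (suc n) * powers L 0) (ℕP.*-zeroʳ w)) (ℚP.*-identityˡ (powers L 0)))))
    exactHits-closedForm (suc L) (suc k) = begin
      ι (c ℕ.* exactHits m w L (suc k) ℕ.+ d ℕ.* exactHits m w L k)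
        ≡⟨ trans (ι-homo-+ (c ℕ.* exactHits m w L (suc k)) (d ℕ.* exactHits m w L k)) (cong₂ _+_ (ι-homo-* c (exactHits m w L (suc k))) (ι-homo-* d (exactHits m w L k))) ⟩
      ι c * ι (exactHits m w L (suc k)) + ι d * ι (exactHits m w L k)
        ≡⟨ cong₂ (λ x y → ι c * x + ι d * y) (exactHits-closedForm L (suc k)) (exactHits-closedForm L k) ⟩
      ι c * (ι (m C suc k) * Δ (suc k) (powers L)) + ι d * (ι (m C k) * Δ k (powers L))
        ≡⟨ cong (λ x → ι c * (ι (m C suc k) * Δ (suc k) (powers L)) + x) (trans (sym (ℚP.*-assoc (ι d) (ι (m C k)) (Δ k (powers L)))) (cong (_* Δ k (powers L)) d-absorb)) ⟩
      ι c * (ι (m C suc k) * Δ (suc k) (powers L)) + ι w * ι (suc k) * ι (m C suc k) * Δ k (powers L)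
        ≡⟨ solve 6 (λ c C x w K y → c :* (C :* x) :+ w :* K :* C :* y := C :* (c :* x :+ w :* K :* y)) refl (ι c) (ι (m C suc k)) (Δ (suc k) (powers L)) (ι w) (ι (suc k)) (Δ k (powers L)) ⟩
      ι (m C suc k) * (ι c * Δ (suc k) (powers L) + ι w * ι (suc k) * Δ k (powers L))
        ≡⟨ cong (ι (m C suc k) *_) (sym (Δ-powers-suc k L)) ⟩
      ι (m C suc k) * Δ (suc k) (powers (suc L)) ∎
      where
      c = 1 ℕ.+ w ℕ.* suc k
      d = w ℕ.* (m ∸ k)
      d-absorb : ι d * ι (m C k) ≡ ι w * ι (suc k) * ι (m C suc k)
      d-absorb = begin
        ι d * ι (m C k)                       ≡⟨ sym (ι-homo-* d (m C k)) ⟩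
        ι (w ℕ.* (m ∸ k) ℕ.* (m C k))
          ≡⟨ cong ι (trans (ℕP.*-assoc w (m ∸ k) (m C k)) (cong (w ℕ.*_) (trans (ℕP.*-comm (m ∸ k) (m C k)) (sym (nC[1+k]*[1+k]≡nCk*[n∸k] m k))))) ⟩
        ι (w ℕ.* ((m C suc k) ℕ.* suc k))     ≡⟨ trans (ι-homo-* w ((m C suc k) ℕ.* suc k)) (cong (ι w *_) (ι-homo-* (m C suc k) (suc k))) ⟩
        ι w * (ι (m C suc k) * ι (suc k))     ≡⟨ solve 3 (λ w C K → w :* (C :* K) := w :* K :* C) refl (ι w) (ι (m C suc k)) (ι (suc k)) ⟩
        ι w * ι (suc k) * ι (m C suc k)       ∎

  sumTo≡∑< : ∀ k g → sumTo k g ≡ ∑< (suc k) g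
  sumTo≡∑< k g = foldr-applyUpTo (suc k) (λ j → j)
    where
    foldr-applyUpTo : ∀ n (f : ℕ → ℕ) → foldr _+_ 0ℚ (map g (applyUpTo f n)) ≡ ∑< n (λ j → g (f j))
    foldr-applyUpTo zero f = refl
    foldr-applyUpTo (suc n) f = cong (g (f 0) +_) (foldr-applyUpTo n (λ j → f (suc j)))

  module _ (o t′ w : ℕ) where

    private
      q = suc o
      t = suc t′
      u = ℤ.+ 1 ℚ./ q

      u*q≡1 : u * ι q ≡ 1ℚ
      u*q≡1 = [z/n]*n≡z (ℤ.+ 1) q

    1/q+wtj/tq≡[1+wj]/q : ∀ j → ((ℤ.+ 1) /ℚ q) + ((ℤ.+ (w ℕ.* t ℕ.* j)) /ℚ (t ℕ.* q)) ≡ ι (1 ℕ.+ w ℕ.* j) * u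
    1/q+wtj/tq≡[1+wj]/q j = *-cancelʳ-ι _ _ (t ℕ.* q) (begin
      (u + z) * ι (t ℕ.* q)                   ≡⟨ cong ((u + z) *_) (ι-homo-* t q) ⟩
      (u + z) * (ι t * ι q)                   ≡⟨ solve 4 (λ u z t q → (u :+ z) :* (t :* q) := (u :* q) :* t :+ z :* (t :* q)) refl u z (ι t) (ι q) ⟩
      (u * ι q) * ι t + z * (ι t * ι q)
        ≡⟨ cong₂ (λ a b → a * ι t + b) u*q≡1 (trans (cong (z *_) (sym (ι-homo-* t q))) ([z/n]*n≡z (ℤ.+ (w ℕ.* t ℕ.* j)) (t ℕ.* q))) ⟩
      1ℚ * ι t + ι (w ℕ.* t ℕ.* j)            ≡⟨ cong (1ℚ * ι t +_) (trans (ι-homo-* (w ℕ.* t) j) (cong (_* ι j) (ι-homo-* w t))) ⟩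
      1ℚ * ι t + ι w * ι t * ι j
        ≡⟨ solve 3 (λ t w j → con 1ℚ :* t :+ w :* t :* j := (con 1ℚ :+ w :* j) :* con 1ℚ :* t) refl (ι t) (ι w) (ι j) ⟩
      (1ℚ + ι w * ι j) * 1ℚ * ι t
        ≡⟨ cong₂ (λ a b → a * b * ι t) (trans (cong (1ℚ +_) (sym (ι-homo-* w j))) (sym (ι-homo-+ 1 (w ℕ.* j)))) (sym u*q≡1) ⟩
      ι (1 ℕ.+ w ℕ.* j) * (u * ι q) * ι t     ≡⟨ solve 4 (λ x u q t → x :* (u :* q) :* t := x :* u :* (t :* q)) refl (ι (1 ℕ.+ w ℕ.* j)) u (ι q) (ι t) ⟩
      ι (1 ℕ.+ w ℕ.* j) * u * (ι t * ι q)     ≡⟨ cong (ι (1 ℕ.+ w ℕ.* j) * u *_) (sym (ι-homo-* t q)) ⟩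
      ι (1 ℕ.+ w ℕ.* j) * u * ι (t ℕ.* q)     ∎)
      where z = (ℤ.+ (w ℕ.* t ℕ.* j)) ℚ./ (t ℕ.* q)

    rhs≡exactHits*u^ℓ : ∀ ℓ k → rhs q ℓ (w ℕ.* t) t k ≡ ι (exactHits (t ℕ.* ℓ) w ℓ k) * u ^ℚ ℓ
    rhs≡exactHits*u^ℓ ℓ k = begin
      ι (t ℕ.* ℓ C k) * sumTo k (λ j → signedC k j * (X j ^ℚ ℓ))
        ≡⟨ cong (ι (t ℕ.* ℓ C k) *_) (trans (sumTo≡∑< k (λ j → signedC k j * (X j ^ℚ ℓ))) (∑<-cong (suc k) (λ j _ → cong (signedC k j *_) (term j)))) ⟩
      ι (t ℕ.* ℓ C k) * Δ k (λ j → u ^ℚ ℓ * powers j)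
        ≡⟨ cong (ι (t ℕ.* ℓ C k) *_) (sym (*-distribˡ-Δ k (u ^ℚ ℓ) powers)) ⟩
      ι (t ℕ.* ℓ C k) * (u ^ℚ ℓ * Δ k powers)
        ≡⟨ solve 3 (λ c v d → c :* (v :* d) := c :* d :* v) refl (ι (t ℕ.* ℓ C k)) (u ^ℚ ℓ) (Δ k powers) ⟩
      ι (t ℕ.* ℓ C k) * Δ k powers * u ^ℚ ℓ
        ≡⟨ cong (_* u ^ℚ ℓ) (sym (exactHits-closedForm (t ℕ.* ℓ) w ℓ k)) ⟩
      ι (exactHits (t ℕ.* ℓ) w ℓ k) * u ^ℚ ℓ ∎
      where
      X : ℕ → ℚ
      X j = ((ℤ.+ 1) /ℚ q) + ((ℤ.+ (w ℕ.* t ℕ.* j)) /ℚ (t ℕ.* q))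
      powers : ℕ → ℚ
      powers j = ι (1 ℕ.+ w ℕ.* j) ^ℚ ℓ
      term : ∀ j → X j ^ℚ ℓ ≡ u ^ℚ ℓ * powers j
      term j = trans (cong (_^ℚ ℓ) (1/q+wtj/tq≡[1+wj]/q j)) (trans (^ℚ-distrib-* (ι (1 ℕ.+ w ℕ.* j)) u ℓ) (ℚP.*-comm (powers j) (u ^ℚ ℓ)))

    A/q^ℓ≡A*u^ℓ : ∀ A ℓ d → q ℕ.^ ℓ ≡ suc d → (ℤ.+ A) ℚ./ suc d ≡ ι A * u ^ℚ ℓ
    A/q^ℓ≡A*u^ℓ A ℓ d q^ℓ≡1+d = *-cancelʳ-ι _ _ (suc d) (begin
      (ℤ.+ A ℚ./ suc d) * ι (suc d)      ≡⟨ [z/n]*n≡z (ℤ.+ A) (suc d) ⟩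
      ι A                                ≡⟨ solve 1 (λ a → a := a :* con 1ℚ) refl (ι A) ⟩
      ι A * 1ℚ                           ≡⟨ cong (ι A *_) (sym (trans (cong (_^ℚ ℓ) u*q≡1) (1^ℚn≡1 ℓ))) ⟩
      ι A * (u * ι q) ^ℚ ℓ               ≡⟨ cong (ι A *_) (^ℚ-distrib-* u (ι q) ℓ) ⟩
      ι A * (u ^ℚ ℓ * ι q ^ℚ ℓ)          ≡⟨ sym (ℚP.*-assoc (ι A) (u ^ℚ ℓ) (ι q ^ℚ ℓ)) ⟩
      ι A * u ^ℚ ℓ * ι q ^ℚ ℓ            ≡⟨ cong (ι A * u ^ℚ ℓ *_) (trans (sym (ι-homo-^ q ℓ)) (cong ι q^ℓ≡1+d)) ⟩
      ι A * u ^ℚ ℓ * ι (suc d)           ∎)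

module NumberTheory where

  open import Data.Nat
  open import Data.Nat.Properties
  open import Data.Nat.DivMod using (_%_; _/_; m≡m%n+[m/n]*n; [m+kn]%n≡m%n; m∣n⇒o%n%m≡o%m)
  open import Data.Nat.Divisibility using (_∣_; divides)
  open import Data.Nat.GCD using (gcd; gcd-GCD; gcd[m,n]∣n; module Bézout)
  open import Data.Product using (Σ; _×_; _,_)
  open import Relation.Nullary using (contradiction)
  open import Relation.Binary.PropositionalEquality
  open import Data.Nat.Solver using (module +-*-Solver)
  open +-*-Solver
  open ≡-Reasoning

  gcd-lincomb : ∀ r s t .{{_ : NonZero s}} → t ≡ gcd r s → Σ ℕ λ X → Σ ℕ λ P → Σ ℕ λ Q → r * X + s * P ≡ t + s * Q
  gcd-lincomb r s@(suc s′) t refl with Bézout.identity (gcd-GCD r s)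
  ... | Bézout.+- x y eq = x , 0 , y , (begin
    r * x + s * 0              ≡⟨ solve 3 (λ r x s → r :* x :+ s :* con 0 := x :* r) refl r x s ⟩
    x * r                      ≡⟨ sym eq ⟩
    t + y * s                  ≡⟨ cong (t +_) (*-comm y s) ⟩
    t + s * y                  ∎)
  ... | Bézout.-+ x y eq = x * s′ , t , y * s′ , (begin
    r * (x * s′) + suc s′ * t  ≡⟨ solve 4 (λ r x s t → r :* (x :* s) :+ (con 1 :+ s) :* t := (t :+ x :* r) :* s :+ t) refl r x s′ t ⟩
    (t + x * r) * s′ + t       ≡⟨ cong (λ n → n * s′ + t) eq ⟩
    y * suc s′ * s′ + t        ≡⟨ solve 3 (λ y s t → y :* (con 1 :+ s) :* s :+ t := t :+ (con 1 :+ s) :* (y :* s)) refl y s′ t ⟩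
    t + suc s′ * (y * s′)      ∎)

  %≡%⇒+*≡+* : ∀ u v M .{{_ : NonZero M}} → u % M ≡ v % M → u + (v / M) * M ≡ v + (u / M) * M
  %≡%⇒+*≡+* u v M eq = begin
    u + (v / M) * M                     ≡⟨ cong (_+ (v / M) * M) (m≡m%n+[m/n]*n u M) ⟩
    u % M + (u / M) * M + (v / M) * M   ≡⟨ cong (λ n → n + (u / M) * M + (v / M) * M) eq ⟩
    v % M + (u / M) * M + (v / M) * M   ≡⟨ solve 3 (λ a b c → a :+ b :+ c := (a :+ c) :+ b) refl (v % M) ((u / M) * M) ((v / M) * M) ⟩
    v % M + (v / M) * M + (u / M) * M   ≡⟨ cong (_+ (u / M) * M) (sym (m≡m%n+[m/n]*n v M)) ⟩
    v + (u / M) * M                     ∎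

  module _ (ℓ r t w′ : ℕ) {X P Q : ℕ} (bezout : r * X + (suc w′ * t) * P ≡ t + (suc w′ * t) * Q) where

    private
      s = suc w′ * t

      shifted-solution : ∀ u v A B → u + A * (t * ℓ) ≡ v + B * (t * ℓ) →
        let d = A + B * w′ in u + ℓ * r * (X * d) + (P * d) * (s * ℓ) ≡ v + (B + Q * d) * (s * ℓ)
      shifted-solution u v A B eq = begin
        u + ℓ * r * (X * d) + (P * d) * (s * ℓ)
          ≡⟨ solve 7 (λ u ℓ r X d P s → u :+ ℓ :* r :* (X :* d) :+ (P :* d) :* (s :* ℓ) := u :+ ℓ :* d :* (r :* X :+ s :* P)) refl u ℓ r X d P s ⟩
        u + ℓ * d * (r * X + s * P)    ≡⟨ cong (λ n → u + ℓ * d * n) bezout ⟩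
        u + ℓ * d * (t + s * Q)
          ≡⟨ solve 8 (λ u ℓ A B w t Q s → u :+ ℓ :* (A :+ B :* w) :* (t :+ s :* Q)
                       := (u :+ A :* (t :* ℓ)) :+ B :* (w :* (t :* ℓ)) :+ (Q :* (A :+ B :* w)) :* (s :* ℓ)) refl u ℓ A B w′ t Q s ⟩
        (u + A * (t * ℓ)) + B * (w′ * (t * ℓ)) + (Q * d) * (s * ℓ)
          ≡⟨ cong (λ n → n + B * (w′ * (t * ℓ)) + (Q * d) * (s * ℓ)) eq ⟩
        v + B * (t * ℓ) + B * (w′ * (t * ℓ)) + (Q * d) * (s * ℓ)
          ≡⟨ solve 6 (λ v B w t ℓ q → v :+ B :* (t :* ℓ) :+ B :* (w :* (t :* ℓ)) :+ q :* ((con 1 :+ w) :* t :* ℓ)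
                       := v :+ (B :+ q) :* ((con 1 :+ w) :* t :* ℓ)) refl v B w′ t ℓ (Q * d) ⟩
        v + (B + Q * d) * (s * ℓ) ∎
        where d = A + B * w′

    linear-congruence : ∀ u v .{{_ : NonZero (t * ℓ)}} .{{_ : NonZero (s * ℓ)}} → u % (t * ℓ) ≡ v % (t * ℓ) →
                        Σ ℕ λ d → (u + ℓ * r * d) % (s * ℓ) ≡ v % (s * ℓ)
    linear-congruence u v u≡v = X * d , (begin
      (u + ℓ * r * (X * d)) % (s * ℓ)                       ≡⟨ sym ([m+kn]%n≡m%n _ (P * d) (s * ℓ)) ⟩
      (u + ℓ * r * (X * d) + (P * d) * (s * ℓ)) % (s * ℓ)   ≡⟨ cong (_% (s * ℓ)) (shifted-solution u v A B (%≡%⇒+*≡+* u v (t * ℓ) u≡v)) ⟩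
      (v + (B + Q * d) * (s * ℓ)) % (s * ℓ)                 ≡⟨ [m+kn]%n≡m%n v (B + Q * d) (s * ℓ) ⟩
      v % (s * ℓ)                                           ∎)
      where
      A = v / (t * ℓ)
      B = u / (t * ℓ)
      d = A + B * w′

  [α+e*r]%o%tℓ≡[α+[e%ℓ]*r]%tℓ : ∀ ℓ t {r o} .{{_ : NonZero ℓ}} .{{_ : NonZero (t * ℓ)}} .{{_ : NonZero o}} →
                                 t ∣ r → t * ℓ ∣ o → ∀ α e → (α + e * r) % o % (t * ℓ) ≡ (α + (e % ℓ) * r) % (t * ℓ)
  [α+e*r]%o%tℓ≡[α+[e%ℓ]*r]%tℓ ℓ t {o = o} (divides r′ refl) tℓ∣o α e = begin
    (α + e * (r′ * t)) % o % (t * ℓ)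
      ≡⟨ m∣n⇒o%n%m≡o%m (t * ℓ) o _ tℓ∣o ⟩
    (α + e * (r′ * t)) % (t * ℓ)
      ≡⟨ cong (λ n → (α + n * (r′ * t)) % (t * ℓ)) (m≡m%n+[m/n]*n e ℓ) ⟩
    (α + (e % ℓ + (e / ℓ) * ℓ) * (r′ * t)) % (t * ℓ)
      ≡⟨ cong (_% (t * ℓ)) (solve 6 (λ α E D ℓ r t → α :+ (E :+ D :* ℓ) :* (r :* t) := α :+ E :* (r :* t) :+ (D :* r) :* (t :* ℓ)) refl α (e % ℓ) (e / ℓ) ℓ r′ t) ⟩
    (α + (e % ℓ) * (r′ * t) + ((e / ℓ) * r′) * (t * ℓ)) % (t * ℓ)
      ≡⟨ [m+kn]%n≡m%n (α + (e % ℓ) * (r′ * t)) ((e / ℓ) * r′) (t * ℓ) ⟩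
    (α + (e % ℓ) * (r′ * t)) % (t * ℓ) ∎

  gcd-cofactor : ∀ r s t .{{_ : NonZero s}} → t ≡ gcd r s → Σ ℕ λ t′ → Σ ℕ λ w′ → t ≡ suc t′ × s ≡ suc w′ * suc t′
  gcd-cofactor r s t t≡gcd with gcd[m,n]∣n r s
  ... | divides w s≡w*gcd = by-cases t w (subst (λ g → s ≡ w * g) (sym t≡gcd) s≡w*gcd)
    where
    by-cases : ∀ t w → s ≡ w * t → Σ ℕ λ t′ → Σ ℕ λ w′ → t ≡ suc t′ × s ≡ suc w′ * suc t′
    by-cases zero w s≡0 = contradiction (trans s≡0 (*-zeroʳ w)) (≢-nonZero⁻¹ s)
    by-cases (suc t′) zero s≡0 = contradiction s≡0 (≢-nonZero⁻¹ s)
    by-cases (suc t′) (suc w′) s≡w*t = t′ , w′ , refl , s≡w*t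

module FiniteFields where

  open import Data.Nat as ℕ using (ℕ; zero; suc; _<_; _≤_; z≤n; s≤s; _∸_)
  import Data.Nat.Properties as ℕP
  open import Data.Nat.DivMod using (_%_; _/_; m≡m%n+[m/n]*n; m%n<n; m<n⇒m%n≡m)
  open import Data.Fin as Fin using (Fin; toℕ; fromℕ<)
  import Data.Fin.Properties as FinP
  open import Data.Fin.Permutation using (Permutation; permutation; ↔⇒≡)
  open import Data.Product using (Σ; ∃; ∃₂; _×_; _,_; proj₁; proj₂)
  open import Data.Empty using (⊥-elim)
  open import Data.Sum using (inj₁; inj₂)
  open import Function using (_∘_)
  open import Relation.Nullary using (¬_; Dec; yes; no)
  open import Relation.Binary using (Setoid; tri<; tri≈; tri>)
  import Relation.Binary.PropositionalEquality as ≡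
  open ≡ using (_≡_; _≢_)
  open import Algebra.Properties.Semiring.Sum ℕP.+-*-semiring using (sum-syntax; sum-permute; sum-cong-≗)
  import Algebra.Properties.Semiring.Exp as Exp
  open IndexedSum ℕP.+-*-semiring
  open import Defs
  open import Data.Maybe using (Maybe; nothing; just)
  open Counting using (∑<-mod)

  Least : (ℕ → Set) → ℕ → Set
  Least P m = P m × (∀ k → k < m → ¬ P k)

  least : ∀ {P : ℕ → Set} → (∀ n → Dec (P n)) → ∀ n → P n → Σ ℕ (Least P)
  least {P} P? n pn = search n 0 (λ _ ()) (ℕP.+-identityʳ n)
    where
    search : ∀ fuel b → (∀ k → k < b → ¬ P k) → fuel ℕ.+ b ≡ n → Σ ℕ (Least P)
    search fuel b below eq with P? b
    ... | yes pb = b , pb , below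
    search zero b below eq | no ¬pb = ⊥-elim (¬pb (≡.subst P (≡.sym eq) pn))
    search (suc fuel) b below eq | no ¬pb = search fuel (suc b) below′ (≡.trans (ℕP.+-suc fuel b) eq)
      where
      below′ : ∀ k → k < suc b → ¬ P k
      below′ k (s≤s k≤b) with ℕP.m≤n⇒m<n∨m≡n k≤b
      ... | inj₁ k<b = below k k<b
      ... | inj₂ ≡.refl = ¬pb

  pigeonhole-avoiding : ∀ {n} (z : Fin n) (g : Fin n → Fin n) → (∀ i → g i ≢ z) → ∃₂ λ i j → toℕ i < toℕ j × g i ≡ g j
  pigeonhole-avoiding {suc n} z g avoid with FinP.pigeonhole (ℕP.n<1+n n) (λ i → Fin.punchOut (avoid i ∘ ≡.sym))
  ... | i , j , i<j , eq = i , j , i<j , FinP.punchOut-injective (avoid i ∘ ≡.sym) (avoid j ∘ ≡.sym) eq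

  module _ {c ℓ} (S : Setoid c ℓ) where
    open Setoid S

    module _ {m n} (E₁ : Fin m → Carrier) (E₂ : Fin n → Carrier)
             (surj₁ : ∀ x → ∃ λ i → E₁ i ≈ x) (surj₂ : ∀ x → ∃ λ j → E₂ j ≈ x)
             (inj₁ : ∀ i i′ → E₁ i ≈ E₁ i′ → i ≡ i′) (inj₂ : ∀ j j′ → E₂ j ≈ E₂ j′ → j ≡ j′) where

      enumerations-permutation : Permutation m n
      enumerations-permutation = permutation (proj₁ ∘ surj₂ ∘ E₁) (proj₁ ∘ surj₁ ∘ E₂)
        (λ j → inj₂ _ _ (trans (proj₂ (surj₂ _)) (proj₂ (surj₁ (E₂ j)))))
        (λ i → inj₁ _ _ (trans (proj₂ (surj₁ _)) (proj₂ (surj₂ (E₁ i)))))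

      enumerations-size : m ≡ n
      enumerations-size = ↔⇒≡ enumerations-permutation

      ∑-enumerations : (H : Carrier → ℕ) → (∀ {x y} → x ≈ y → H x ≡ H y) →
                       ∑[ i < m ] H (E₁ i) ≡ ∑[ j < n ] H (E₂ j)
      ∑-enumerations H H-cong = ≡.sym (≡.trans (sum-permute (H ∘ E₂) enumerations-permutation)
        (sum-cong-≗ {m} (λ i → H-cong (proj₂ (surj₂ (E₁ i))))))

  module FieldBasics (F : FiniteField) where
    open FiniteField F hiding (zero)
    open import Relation.Binary.Reasoning.Setoid setoid

    *-cancelˡ-≉0 : ∀ {x a b} → ¬ (x ≈ 0#) → x * a ≈ x * b → a ≈ b
    *-cancelˡ-≉0 {x} {a} {b} x≉0 eq with inverse x x≉0
    ... | x⁻¹ , xx⁻¹≈1 = begin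
      a                ≈⟨ sym (*-identityˡ a) ⟩
      1# * a           ≈⟨ *-congʳ (sym x⁻¹x≈1) ⟩
      (x⁻¹ * x) * a    ≈⟨ *-assoc x⁻¹ x a ⟩
      x⁻¹ * (x * a)    ≈⟨ *-congˡ eq ⟩
      x⁻¹ * (x * b)    ≈⟨ sym (*-assoc x⁻¹ x b) ⟩
      (x⁻¹ * x) * b    ≈⟨ *-congʳ x⁻¹x≈1 ⟩
      1# * b           ≈⟨ *-identityˡ b ⟩
      b                ∎
      where x⁻¹x≈1 = trans (*-comm x⁻¹ x) xx⁻¹≈1

    *-≉0 : ∀ {x y} → ¬ (x ≈ 0#) → ¬ (y ≈ 0#) → ¬ (x * y ≈ 0#)
    *-≉0 {x} {y} x≉0 y≉0 xy≈0 = y≉0 (*-cancelˡ-≉0 x≉0 (trans xy≈0 (sym (zeroʳ x))))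

    index : Carrier → Fin size
    index x = proj₁ (enum-surj x)

    enum-index : ∀ x → enum (index x) ≈ x
    enum-index x = proj₂ (enum-surj x)

  module PrimitiveElement (F : FiniteField) (γ : FiniteField.Carrier F) (prim : FiniteField.IsPrimitive F γ) where
    open FiniteField F hiding (zero)
    open FieldBasics F public
    open Exp semiring using (^-homo-*; ^-assocʳ; ^-congˡ)
    open import Relation.Binary.Reasoning.Setoid setoid

    γ^≉0 : ∀ e → ¬ (γ ^ e ≈ 0#)
    γ^≉0 zero = 1≉0
    γ^≉0 (suc e) = *-≉0 (proj₁ prim) (γ^≉0 e)

    γ^-cancel : ∀ a d → γ ^ (a ℕ.+ d) ≈ γ ^ a → γ ^ d ≈ 1#
    γ^-cancel a d eq = *-cancelˡ-≉0 (γ^≉0 a) (begin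
      γ ^ a * γ ^ d   ≈⟨ sym (^-homo-* γ a d) ⟩
      γ ^ (a ℕ.+ d)   ≈⟨ eq ⟩
      γ ^ a           ≈⟨ sym (*-identityʳ (γ ^ a)) ⟩
      γ ^ a * 1#      ∎)

    PositiveOrder : ℕ → Set
    PositiveOrder n = (1 ≤ n) × (γ ^ n ≈ 1#)

    some-order : Σ ℕ PositiveOrder
    some-order with pigeonhole-avoiding (index 0#) (λ i → index (γ ^ toℕ i)) avoids-0
      where
      avoids-0 : ∀ i → index (γ ^ toℕ i) ≢ index 0#
      avoids-0 i eq = γ^≉0 (toℕ i) (trans (sym (enum-index _)) (≡.subst (λ j → enum j ≈ 0#) (≡.sym eq) (enum-index 0#)))
    ... | i , j , i<j , eq = toℕ j ∸ toℕ i , ℕP.m<n⇒0<n∸m i<j , γ^-cancel (toℕ i) _ (begin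
      γ ^ (toℕ i ℕ.+ (toℕ j ∸ toℕ i))  ≡⟨ ≡.cong (γ ^_) (ℕP.m+[n∸m]≡n (ℕP.<⇒≤ i<j)) ⟩
      γ ^ toℕ j                        ≈⟨ sym (enum-index _) ⟩
      enum (index (γ ^ toℕ j))         ≡⟨ ≡.cong enum (≡.sym eq) ⟩
      enum (index (γ ^ toℕ i))         ≈⟨ enum-index _ ⟩
      γ ^ toℕ i                        ∎)

    private
      PositiveOrder? : ∀ n → Dec (PositiveOrder n)
      PositiveOrder? zero = no (λ ())
      PositiveOrder? (suc n) with (γ ^ suc n) ≈? 1#
      ... | yes p = yes (s≤s z≤n , p)
      ... | no ¬p = no (¬p ∘ proj₂)

      least-order : Σ ℕ (Least PositiveOrder)
      least-order = least PositiveOrder? (proj₁ some-order) (proj₂ some-order)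

    abstract
      ord : ℕ
      ord = proj₁ least-order

      1≤ord : 1 ≤ ord
      1≤ord = proj₁ (proj₁ (proj₂ least-order))

      γ^ord≈1 : γ ^ ord ≈ 1#
      γ^ord≈1 = proj₂ (proj₁ (proj₂ least-order))

      ord-minimal : ∀ k → k < ord → ¬ PositiveOrder k
      ord-minimal = proj₂ (proj₂ least-order)

    instance
      ord-nonZero : ℕ.NonZero ord
      ord-nonZero = ℕ.>-nonZero 1≤ord

    γ^[a+k*ord]≈γ^a : ∀ a k → γ ^ (a ℕ.+ k ℕ.* ord) ≈ γ ^ a
    γ^[a+k*ord]≈γ^a a k = begin
      γ ^ (a ℕ.+ k ℕ.* ord)        ≈⟨ ^-homo-* γ a (k ℕ.* ord) ⟩
      γ ^ a * γ ^ (k ℕ.* ord)      ≡⟨ ≡.cong (λ n → γ ^ a * γ ^ n) (ℕP.*-comm k ord) ⟩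
      γ ^ a * γ ^ (ord ℕ.* k)      ≈⟨ *-congˡ (sym (^-assocʳ γ ord k)) ⟩
      γ ^ a * (γ ^ ord) ^ k        ≈⟨ *-congˡ (^-congˡ k γ^ord≈1) ⟩
      γ ^ a * 1# ^ k               ≈⟨ *-congˡ (1^k≈1 k) ⟩
      γ ^ a * 1#                   ≈⟨ *-identityʳ (γ ^ a) ⟩
      γ ^ a                        ∎
      where
      1^k≈1 : ∀ k → 1# ^ k ≈ 1#
      1^k≈1 zero = refl
      1^k≈1 (suc k) = trans (*-identityˡ (1# ^ k)) (1^k≈1 k)

    γ^e≈γ^[e%ord] : ∀ e → γ ^ e ≈ γ ^ (e % ord)
    γ^e≈γ^[e%ord] e = begin
      γ ^ e                                ≡⟨ ≡.cong (γ ^_) (m≡m%n+[m/n]*n e ord) ⟩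
      γ ^ (e % ord ℕ.+ (e / ord) ℕ.* ord)  ≈⟨ γ^[a+k*ord]≈γ^a (e % ord) (e / ord) ⟩
      γ ^ (e % ord)                        ∎

    %≡⇒γ^≈γ^ : ∀ n .{{_ : ℕ.NonZero n}} → ord ≡ n → ∀ a b → a % n ≡ b % n → γ ^ a ≈ γ ^ b
    %≡⇒γ^≈γ^ _ ≡.refl a b eq = trans (γ^e≈γ^[e%ord] a) (trans (reflexive (≡.cong (γ ^_) eq)) (sym (γ^e≈γ^[e%ord] b)))

    γ^-distinct : ∀ a b → a < b → b < ord → ¬ (γ ^ a ≈ γ ^ b)
    γ^-distinct a b a<b b<ord eq = ord-minimal (b ∸ a) (ℕP.≤-<-trans (ℕP.m∸n≤m b a) b<ord)
      (ℕP.m<n⇒0<n∸m a<b , γ^-cancel a (b ∸ a) (trans (reflexive (≡.cong (γ ^_) (ℕP.m+[n∸m]≡n (ℕP.<⇒≤ a<b)))) (sym eq)))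

    γ^-injective : ∀ a b → a < ord → b < ord → γ ^ a ≈ γ ^ b → a ≡ b
    γ^-injective a b a<ord b<ord eq with ℕP.<-cmp a b
    ... | tri< a<b _ _ = ⊥-elim (γ^-distinct a b a<b b<ord eq)
    ... | tri≈ _ a≡b _ = a≡b
    ... | tri> _ _ b<a = ⊥-elim (γ^-distinct b a b<a a<ord (sym eq))

    γ^≈γ^⇒%ord≡ : ∀ a b → γ ^ a ≈ γ ^ b → a % ord ≡ b % ord
    γ^≈γ^⇒%ord≡ a b eq = γ^-injective (a % ord) (b % ord) (m%n<n a ord) (m%n<n b ord)
      (trans (sym (γ^e≈γ^[e%ord] a)) (trans eq (γ^e≈γ^[e%ord] b)))

    -- log 0 is a junk value.
    log : Carrier → ℕ
    log x with x ≈? 0#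
    ... | yes _ = 0
    ... | no x≉0 = proj₁ (proj₂ prim x x≉0) % ord

    log<ord : ∀ x → log x < ord
    log<ord x with x ≈? 0#
    ... | yes _ = 1≤ord
    ... | no _ = m%n<n _ ord

    γ^log : ∀ x → ¬ (x ≈ 0#) → γ ^ log x ≈ x
    γ^log x x≉0 with x ≈? 0#
    ... | yes x≈0 = ⊥-elim (x≉0 x≈0)
    ... | no x≉0′ = trans (sym (γ^e≈γ^[e%ord] (proj₁ (proj₂ prim x x≉0′)))) (proj₂ (proj₂ prim x x≉0′))

    log-unique : ∀ x e → ¬ (x ≈ 0#) → γ ^ e ≈ x → e < ord → log x ≡ e
    log-unique x e x≉0 eq e<ord = γ^-injective (log x) e (log<ord x) e<ord (trans (γ^log x x≉0) (sym eq))

    log-γ^ : ∀ e → log (γ ^ e) ≡ e % ord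
    log-γ^ e = log-unique (γ ^ e) (e % ord) (γ^≉0 e) (sym (γ^e≈γ^[e%ord] e)) (m%n<n e ord)

    log-cong : ∀ {x y} → x ≈ y → ¬ (x ≈ 0#) → log x ≡ log y
    log-cong {x} {y} x≈y x≉0 = ≡.sym (log-unique y (log x) (x≉0 ∘ trans x≈y) (trans (γ^log x x≉0) x≈y) (log<ord x))

    zero-or-power : Fin (suc ord) → Carrier
    zero-or-power Fin.zero = 0#
    zero-or-power (Fin.suc e) = γ ^ toℕ e

    private
      zero-or-power-surj : ∀ x → ∃ λ i → zero-or-power i ≈ x
      zero-or-power-surj x with x ≈? 0#
      ... | yes x≈0 = Fin.zero , sym x≈0
      ... | no x≉0 = Fin.suc (fromℕ< (log<ord x)) , trans (reflexive (≡.cong (γ ^_) (FinP.toℕ-fromℕ< (log<ord x)))) (γ^log x x≉0)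

      zero-or-power-inj : ∀ i j → zero-or-power i ≈ zero-or-power j → i ≡ j
      zero-or-power-inj Fin.zero Fin.zero _ = ≡.refl
      zero-or-power-inj Fin.zero (Fin.suc j) eq = ⊥-elim (γ^≉0 (toℕ j) (sym eq))
      zero-or-power-inj (Fin.suc i) Fin.zero eq = ⊥-elim (γ^≉0 (toℕ i) eq)
      zero-or-power-inj (Fin.suc i) (Fin.suc j) eq =
        ≡.cong Fin.suc (FinP.toℕ-injective (γ^-injective (toℕ i) (toℕ j) (FinP.toℕ<n i) (FinP.toℕ<n j) eq))

    size≡1+ord : size ≡ suc ord
    size≡1+ord = enumerations-size setoid enum zero-or-power enum-surj zero-or-power-surj enum-inj zero-or-power-inj

    ∑-field : (H : Carrier → ℕ) → (∀ {x y} → x ≈ y → H x ≡ H y) →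
              ∑[ i < size ] H (enum i) ≡ H 0# ℕ.+ ∑< ord (λ e → H (γ ^ e))
    ∑-field = ∑-enumerations setoid enum zero-or-power enum-surj zero-or-power-surj enum-inj zero-or-power-inj

  module Labels (F : FiniteField) (γ : FiniteField.Carrier F) (prim : FiniteField.IsPrimitive F γ)
                (M w : ℕ) .{{_ : ℕ.NonZero M}} (ord≡w*M : PrimitiveElement.ord F γ prim ≡ w ℕ.* M) where
    open FiniteField F hiding (zero)
    open PrimitiveElement F γ prim

    private
      label-by : ℕ → (y : Carrier) → Dec (y ≈ 0#) → Maybe ℕ
      label-by c y (yes _) = nothing
      label-by c y (no _) = just ((log y ℕ.+ c) % M)

    label : ℕ → Carrier → Maybe ℕ
    label c y = label-by c y (y ≈? 0#)

    label-cong : ∀ c {x y} → x ≈ y → label c x ≡ label c y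
    label-cong c {x} {y} x≈y = go (x ≈? 0#) (y ≈? 0#)
      where
      go : ∀ dx dy → label-by c x dx ≡ label-by c y dy
      go (yes _) (yes _) = ≡.refl
      go (yes x≈0) (no y≉0) = ⊥-elim (y≉0 (trans (sym x≈y) x≈0))
      go (no x≉0) (yes y≈0) = ⊥-elim (x≉0 (trans x≈y y≈0))
      go (no x≉0) (no _) = ≡.cong (λ n → just ((n ℕ.+ c) % M)) (log-cong x≈y x≉0)

    label-0 : ∀ c → label c 0# ≡ nothing
    label-0 c = go (0# ≈? 0#)
      where
      go : ∀ d → label-by c 0# d ≡ nothing
      go (yes _) = ≡.refl
      go (no 0≉0) = ⊥-elim (0≉0 refl)

    label-≉0 : ∀ c y → ¬ (y ≈ 0#) → label c y ≡ just ((log y ℕ.+ c) % M)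
    label-≉0 c y y≉0 = go (y ≈? 0#)
      where
      go : ∀ d → label-by c y d ≡ just ((log y ℕ.+ c) % M)
      go (yes y≈0) = ⊥-elim (y≉0 y≈0)
      go (no _) = ≡.refl

    label≡just : ∀ c y l → label c y ≡ just l → ¬ (y ≈ 0#) × (l ≡ (log y ℕ.+ c) % M)
    label≡just c y l = go (y ≈? 0#)
      where
      go : ∀ d → label-by c y d ≡ just l → ¬ (y ≈ 0#) × (l ≡ (log y ℕ.+ c) % M)
      go (yes _) ()
      go (no y≉0) ≡.refl = y≉0 , ≡.refl

    label-< : ∀ c y l → label c y ≡ just l → l < M
    label-< c y l eq = ≡.subst (_< M) (≡.sym (proj₂ (label≡just c y l eq))) (m%n<n (log y ℕ.+ c) M)

    label-γ^ : ∀ c e → e < ord → label c (γ ^ e) ≡ just ((e ℕ.+ c) % M)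
    label-γ^ c e e<ord = ≡.trans (label-≉0 c (γ ^ e) (γ^≉0 e))
      (≡.cong (λ n → just ((n ℕ.+ c) % M)) (≡.trans (log-γ^ e) (m<n⇒m%n≡m e<ord)))

    ∑-label-fibres : ∀ c (Q : Maybe ℕ → ℕ) → ∑[ j < size ] Q (label c (enum j)) ≡ Q nothing ℕ.+ w ℕ.* ∑< M (Q ∘ just)
    ∑-label-fibres c Q = begin
      ∑[ j < size ] Q (label c (enum j))
        ≡⟨ ∑-field (Q ∘ label c) (≡.cong Q ∘ label-cong c) ⟩
      Q (label c 0#) ℕ.+ ∑< ord (λ e → Q (label c (γ ^ e)))
        ≡⟨ ≡.cong₂ ℕ._+_ (≡.cong Q (label-0 c)) (∑<-cong ord (λ e e<ord → ≡.cong Q (label-γ^ c e e<ord))) ⟩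
      Q nothing ℕ.+ ∑< ord (λ e → Q (just ((e ℕ.+ c) % M)))
        ≡⟨ ≡.cong (λ n → Q nothing ℕ.+ ∑< n (λ e → Q (just ((e ℕ.+ c) % M)))) ord≡w*M ⟩
      Q nothing ℕ.+ ∑< (w ℕ.* M) (λ e → Q (just ((e ℕ.+ c) % M)))
        ≡⟨ ≡.cong (Q nothing ℕ.+_) (∑<-mod w M c (Q ∘ just)) ⟩
      Q nothing ℕ.+ w ℕ.* ∑< M (Q ∘ just) ∎
      where open ≡.≡-Reasoning

module CyclotomicMapping where

  open import Data.Nat as ℕ using (ℕ; zero; suc; _<_; NonZero)
  import Data.Nat.Properties as ℕP
  open import Data.Nat.DivMod using (_%_; _/_; m%n<n; m<n⇒m%n≡m; [m+kn]%n≡m%n; m≡m%n+[m/n]*n; m∣n⇒o%n%m≡o%m)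
  open import Data.Nat.Divisibility using (_∣_; divides)
  open import Data.Fin as Fin using (Fin; toℕ; fromℕ<)
  import Data.Fin.Properties as FinP
  open import Data.Fin.Properties using (any?)
  open import Data.Product using (∃; _×_; _,_; proj₁; proj₂)
  open import Data.Empty using (⊥-elim)
  open import Function using (_∘′_)
  open import Relation.Nullary using (¬_; Dec; yes; no)
  import Relation.Binary.PropositionalEquality as ≡
  open ≡ using (_≡_)
  import Algebra.Properties.Semiring.Exp as Exp
  open import Data.Nat.Solver using (module +-*-Solver)
  open +-*-Solver using (solve; _:+_; _:*_; _:=_)
  open import Defs
  open FiniteFields
  open NumberTheory
  open import Data.Maybe using (Maybe; nothing; just)
  open import Data.Vec using (Vec; lookup)
  open import Data.List using (allFin)
  open import Algebra.Properties.Semiring.Sum ℕP.+-*-semiring using (sum-cong-≗)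
  open Counting

  module _ (F : FiniteField) (γ : FiniteField.Carrier F) (ℓ r : ℕ) (a : Fin ℓ → FiniteField.Carrier F) where
    open FiniteField F hiding (zero)

    cyclotomicMap-0 : ∀ x → x ≈ 0# → cyclotomicMap F γ ℓ r a x ≡ 0#
    cyclotomicMap-0 x x≈0 with x ≈? 0#
    ... | yes _ = ≡.refl
    ... | no x≉0 = ⊥-elim (x≉0 x≈0)

    cyclotomicMap-InClass : ∀ x → ¬ (x ≈ 0#) → (∃ λ i → InClass F γ ℓ i x) →
                            ∃ λ i → InClass F γ ℓ i x × cyclotomicMap F γ ℓ r a x ≡ a i * x ^ r
    cyclotomicMap-InClass x x≉0 in-some-class with x ≈? 0#
    ... | yes x≈0 = ⊥-elim (x≉0 x≈0)
    ... | no _ with any? (λ i → inClass? F γ ℓ i x)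
    ...   | yes (i , x∈Cᵢ) = i , x∈Cᵢ , ≡.refl
    ...   | no no-class = ⊥-elim (no-class in-some-class)

  module Classes (F : FiniteField) (γ : FiniteField.Carrier F) (prim : FiniteField.IsPrimitive F γ)
                 (ℓ : ℕ) .{{_ : NonZero ℓ}} (ℓ∣ord : ℓ ∣ PrimitiveElement.ord F γ prim) where
    open FiniteField F hiding (zero)
    open PrimitiveElement F γ prim
    open Exp semiring using (^-homo-*; ^-assocʳ; ^-congˡ)
    open import Relation.Binary.Reasoning.Setoid setoid

    InClass⇒≡%ℓ : ∀ x e i → x ≈ γ ^ e → InClass F γ ℓ i x → toℕ i ≡ e % ℓ
    InClass⇒≡%ℓ x e i x≈γ^e (m , m≉0 , x≈γⁱmˡ) = ≡.sym e%ℓ≡i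
      where
      d = log (enum m)
      γ^e≈γ^[i+dℓ] : γ ^ e ≈ γ ^ (toℕ i ℕ.+ d ℕ.* ℓ)
      γ^e≈γ^[i+dℓ] = begin
        γ ^ e                         ≈⟨ sym x≈γ^e ⟩
        x                             ≈⟨ x≈γⁱmˡ ⟩
        γ ^ toℕ i * enum m ^ ℓ        ≈⟨ *-congˡ (^-congˡ ℓ (sym (γ^log (enum m) m≉0))) ⟩
        γ ^ toℕ i * (γ ^ d) ^ ℓ       ≈⟨ *-congˡ (^-assocʳ γ d ℓ) ⟩
        γ ^ toℕ i * γ ^ (d ℕ.* ℓ)     ≈⟨ sym (^-homo-* γ (toℕ i) (d ℕ.* ℓ)) ⟩
        γ ^ (toℕ i ℕ.+ d ℕ.* ℓ)       ∎
      e%ℓ≡i : e % ℓ ≡ toℕ i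
      e%ℓ≡i = ≡.trans (≡.trans (≡.sym (m∣n⇒o%n%m≡o%m ℓ ord e ℓ∣ord))
          (≡.trans (≡.cong (_% ℓ) (γ^≈γ^⇒%ord≡ e _ γ^e≈γ^[i+dℓ])) (m∣n⇒o%n%m≡o%m ℓ ord _ ℓ∣ord)))
        (≡.trans ([m+kn]%n≡m%n (toℕ i) d ℓ) (m<n⇒m%n≡m (FinP.toℕ<n i)))

    γ^-InClass : ∀ x e → x ≈ γ ^ e → InClass F γ ℓ (fromℕ< (m%n<n e ℓ)) x
    γ^-InClass x e x≈γ^e = index (γ ^ (e / ℓ)) , (γ^≉0 (e / ℓ) ∘′ trans (sym (enum-index _))) , (begin
      x                                                   ≈⟨ x≈γ^e ⟩
      γ ^ e                                               ≡⟨ ≡.cong (γ ^_) (m≡m%n+[m/n]*n e ℓ) ⟩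
      γ ^ (e % ℓ ℕ.+ (e / ℓ) ℕ.* ℓ)                       ≈⟨ ^-homo-* γ (e % ℓ) _ ⟩
      γ ^ (e % ℓ) * γ ^ ((e / ℓ) ℕ.* ℓ)                   ≈⟨ *-congˡ (sym (^-assocʳ γ (e / ℓ) ℓ)) ⟩
      γ ^ (e % ℓ) * (γ ^ (e / ℓ)) ^ ℓ                     ≈⟨ *-congˡ (^-congˡ ℓ (sym (enum-index _))) ⟩
      γ ^ (e % ℓ) * enum (index (γ ^ (e / ℓ))) ^ ℓ
        ≡⟨ ≡.cong (λ n → γ ^ n * enum (index (γ ^ (e / ℓ))) ^ ℓ) (≡.sym (FinP.toℕ-fromℕ< (m%n<n e ℓ))) ⟩
      γ ^ toℕ (fromℕ< (m%n<n e ℓ)) * enum (index (γ ^ (e / ℓ))) ^ ℓ ∎)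

    cyclotomicMap-γ^ : ∀ r a x e → x ≈ γ ^ e → ∃ λ i → toℕ i ≡ e % ℓ × cyclotomicMap F γ ℓ r a x ≈ a i * γ ^ (e ℕ.* r)
    cyclotomicMap-γ^ r a x e x≈γ^e with cyclotomicMap-InClass F γ ℓ r a x (γ^≉0 e ∘′ trans (sym x≈γ^e)) (fromℕ< (m%n<n e ℓ) , γ^-InClass x e x≈γ^e)
    ... | i , x∈Cᵢ , fx≡ = i , InClass⇒≡%ℓ x e i x≈γ^e x∈Cᵢ , trans (reflexive fx≡) (*-congˡ (trans (^-congˡ r x≈γ^e) (^-assocʳ γ e r)))

    module ValueSet (r t w′ : ℕ) .{{_ : NonZero t}} (t∣r : t ∣ r) (ord≡s*ℓ : ord ≡ (suc w′ ℕ.* t) ℕ.* ℓ)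
                    {X P Q : ℕ} (bezout : r ℕ.* X ℕ.+ (suc w′ ℕ.* t) ℕ.* P ≡ t ℕ.+ (suc w′ ℕ.* t) ℕ.* Q) where

      private
        s = suc w′ ℕ.* t
        M = t ℕ.* ℓ
        instance
          M-nonZero : NonZero M
          M-nonZero = ℕP.m*n≢0 t ℓ
          sℓ-nonZero : NonZero (s ℕ.* ℓ)
          sℓ-nonZero = ℕP.m*n≢0 s ℓ {{ℕP.m*n≢0 (suc w′) t}}

      ord≡w*M : ord ≡ suc w′ ℕ.* M
      ord≡w*M = ≡.trans ord≡s*ℓ (ℕP.*-assoc (suc w′) t ℓ)

      open Labels F γ prim M (suc w′) ord≡w*M

      module _ (a : Fin ℓ → Carrier) where

        f = cyclotomicMap F γ ℓ r a

        preimage-≉0 : ∀ x y → ¬ (y ≈ 0#) → f x ≈ y → ¬ (x ≈ 0#)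
        preimage-≉0 x y y≉0 fx≈y x≈0 = y≉0 (trans (sym fx≈y) (reflexive (cyclotomicMap-0 F γ ℓ r a x x≈0)))

        image⇒label : ∀ y → ¬ (y ≈ 0#) → (∃ λ x → f (enum x) ≈ y) → ∃ λ i → label (toℕ i ℕ.* r) (a i) ≡ label 0 y
        image⇒label y y≉0 (x , fx≈y)
          with cyclotomicMap-γ^ r a (enum x) (log (enum x)) (sym (γ^log (enum x) (preimage-≉0 (enum x) y y≉0 fx≈y)))
        ... | i , i≡e%ℓ , fx≈aᵢγ^er = i , ≡.trans (label-≉0 (toℕ i ℕ.* r) (a i) aᵢ≉0) (≡.trans (≡.cong just same-label) (≡.sym (label-≉0 0 y y≉0)))
          where
          e = log (enum x)
          y≈aᵢγ^er : y ≈ a i * γ ^ (e ℕ.* r)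
          y≈aᵢγ^er = trans (sym fx≈y) fx≈aᵢγ^er
          aᵢ≉0 : ¬ (a i ≈ 0#)
          aᵢ≉0 aᵢ≈0 = y≉0 (trans y≈aᵢγ^er (trans (*-congʳ aᵢ≈0) (zeroˡ _)))
          α = log (a i)
          y≈γ^[α+er] : y ≈ γ ^ (α ℕ.+ e ℕ.* r)
          y≈γ^[α+er] = begin
            y                           ≈⟨ y≈aᵢγ^er ⟩
            a i * γ ^ (e ℕ.* r)         ≈⟨ *-congʳ (sym (γ^log (a i) aᵢ≉0)) ⟩
            γ ^ α * γ ^ (e ℕ.* r)       ≈⟨ sym (^-homo-* γ α (e ℕ.* r)) ⟩
            γ ^ (α ℕ.+ e ℕ.* r)         ∎
          log-y : log y ℕ.+ 0 ≡ (α ℕ.+ e ℕ.* r) % ord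
          log-y = ≡.trans (ℕP.+-identityʳ (log y)) (≡.trans (log-cong y≈γ^[α+er] y≉0) (log-γ^ (α ℕ.+ e ℕ.* r)))
          same-label : (α ℕ.+ toℕ i ℕ.* r) % M ≡ (log y ℕ.+ 0) % M
          same-label = ≡.sym (≡.trans (≡.cong (_% M) log-y)
            (≡.trans ([α+e*r]%o%tℓ≡[α+[e%ℓ]*r]%tℓ ℓ t t∣r (divides (suc w′) ord≡w*M) α e) (≡.cong (λ n → (α ℕ.+ n ℕ.* r) % M) (≡.sym i≡e%ℓ))))

        label⇒image : ∀ y i → ¬ (y ≈ 0#) → label (toℕ i ℕ.* r) (a i) ≡ label 0 y → ∃ λ x → f (enum x) ≈ y
        label⇒image y i y≉0 same = x , (begin
          f (enum x)                      ≈⟨ fx≈aᵢ′γ^er ⟩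
          a i′ * γ ^ (e ℕ.* r)            ≡⟨ ≡.cong (λ j → a j * γ ^ (e ℕ.* r)) i′≡i ⟩
          a i * γ ^ (e ℕ.* r)             ≈⟨ *-congʳ (sym (γ^log (a i) aᵢ≉0)) ⟩
          γ ^ α * γ ^ (e ℕ.* r)           ≈⟨ sym (^-homo-* γ α (e ℕ.* r)) ⟩
          γ ^ (α ℕ.+ e ℕ.* r)
            ≡⟨ ≡.cong (γ ^_) (solve 5 (λ α i ℓ d r → α :+ (i :+ ℓ :* d) :* r := α :+ i :* r :+ ℓ :* r :* d) ≡.refl α (toℕ i) ℓ d r) ⟩
          γ ^ (u ℕ.+ ℓ ℕ.* r ℕ.* d)       ≈⟨ %≡⇒γ^≈γ^ (s ℕ.* ℓ) ord≡s*ℓ _ _ (proj₂ solution) ⟩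
          γ ^ (log y ℕ.+ 0)               ≡⟨ ≡.cong (γ ^_) (ℕP.+-identityʳ (log y)) ⟩
          γ ^ log y                       ≈⟨ γ^log y y≉0 ⟩
          y                               ∎)
          where
          α = log (a i)
          u = α ℕ.+ toℕ i ℕ.* r
          labels : label (toℕ i ℕ.* r) (a i) ≡ just ((log y ℕ.+ 0) % M)
          labels = ≡.trans same (label-≉0 0 y y≉0)
          aᵢ≉0 : ¬ (a i ≈ 0#)
          aᵢ≉0 = proj₁ (label≡just _ (a i) _ labels)
          solution = linear-congruence ℓ r t w′ bezout u (log y ℕ.+ 0) (≡.sym (proj₂ (label≡just _ (a i) _ labels)))
          d = proj₁ solution
          e = toℕ i ℕ.+ ℓ ℕ.* d
          x = index (γ ^ e)
          image = cyclotomicMap-γ^ r a (enum x) e (enum-index (γ ^ e))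
          i′ = proj₁ image
          fx≈aᵢ′γ^er = proj₂ (proj₂ image)
          i′≡i : i′ ≡ i
          i′≡i = FinP.toℕ-injective (≡.trans (proj₁ (proj₂ image)) (≡.trans (≡.cong (λ n → (toℕ i ℕ.+ n) % ℓ) (ℕP.*-comm ℓ d))
                   (≡.trans ([m+kn]%n≡m%n (toℕ i) d ℓ) (m<n⇒m%n≡m (FinP.toℕ<n i)))))

      open Hits size M (suc w′)

      labelling : Labelling ℓ
      labelling i x = label (toℕ i ℕ.* r) (enum x)

      module _ (c : Vec (Fin size) ℓ) where

        private
          a = λ i → enum (lookup c i)

          in-image? : ∀ y → Dec (∃ λ x → f a (enum x) ≈ enum y)
          in-image? y = any? (λ x → f a (enum x) ≈? enum y)

          hit-or-zero : Maybe ℕ → ℕ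
          hit-or-zero nothing = 1
          hit-or-zero (just l) = χ (hit? labelling c l)

          χ-in-image : ∀ y → χ (in-image? y) ≡ hit-or-zero (label 0 (enum y))
          χ-in-image y = by-cases (enum y ≈? 0#)
            where
            by-cases : Dec (enum y ≈ 0#) → χ (in-image? y) ≡ hit-or-zero (label 0 (enum y))
            by-cases (yes y≈0) = ≡.trans (χ-yes (in-image? y) (index 0# , zero-in-image))
              (≡.cong hit-or-zero (≡.sym (≡.trans (label-cong 0 y≈0) (label-0 0))))
              where
              zero-in-image : f a (enum (index 0#)) ≈ enum y
              zero-in-image = trans (reflexive (cyclotomicMap-0 F γ ℓ r a _ (enum-index 0#))) (sym y≈0)
            by-cases (no y≉0) = ≡.trans
              (χ-⇔ (λ im → let (i , eq) = image⇒label a (enum y) y≉0 im in i , ≡.trans eq (label-≉0 0 (enum y) y≉0))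
                   (λ (i , eq) → label⇒image a (enum y) i y≉0 (≡.trans eq (≡.sym (label-≉0 0 (enum y) y≉0))))
                   (in-image? y) (hit? labelling c _))
              (≡.cong hit-or-zero (≡.sym (label-≉0 0 (enum y) y≉0)))

        valueSetSize≡1+w*hits : valueSetSize F (f a) ≡ 1 ℕ.+ suc w′ ℕ.* hits labelling c
        valueSetSize≡1+w*hits = ≡.trans (countBy≡ΣL {P = λ y → ∃ λ x → f a (enum x) ≈ enum y} in-image? (allFin size))
          (≡.trans (ΣL-tabulate size (λ y → y) (λ y → χ (in-image? y)))
          (≡.trans (sum-cong-≗ {size} χ-in-image)
          (∑-label-fibres 0 hit-or-zero)))

      count-valueSetSize : ∀ k → countBy (λ c → valueSetSize F (f (λ i → enum (lookup c i))) ℕ.≟ (1 ℕ.+ k ℕ.* suc w′))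
                                         (allVecs size ℓ) ≡ exactHits M (suc w′) ℓ k
      count-valueSetSize k = ≡.trans (countBy≡ΣL {P = λ c → size-of c ≡ N} (λ c → size-of c ℕ.≟ N) (allVecs size ℓ))
        (≡.trans (ΣL-cong (allVecs size ℓ) (λ c → χ-⇔ (to c) (from c) (size-of c ℕ.≟ N) (hits labelling c ℕ.≟ k)))
        (count-hits≡exactHits ℓ labelling (λ i → ∑-label-fibres (toℕ i ℕ.* r)) (λ i x → label-< (toℕ i ℕ.* r) (enum x)) k))
        where
        N = 1 ℕ.+ k ℕ.* suc w′
        size-of : Vec (Fin size) ℓ → ℕ
        size-of c = valueSetSize F (f (λ i → enum (lookup c i)))
        to : ∀ c → size-of c ≡ N → hits labelling c ≡ k
        to c eq = ℕP.*-cancelʳ-≡ (hits labelling c) k (suc w′)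
          (≡.trans (ℕP.*-comm (hits labelling c) (suc w′)) (ℕP.suc-injective (≡.trans (≡.sym (valueSetSize≡1+w*hits c)) eq)))
        from : ∀ c → hits labelling c ≡ k → size-of c ≡ N
        from c eq = ≡.trans (valueSetSize≡1+w*hits c) (≡.cong suc (≡.trans (ℕP.*-comm (suc w′) (hits labelling c)) (≡.cong (ℕ._* suc w′) eq)))

open import Defs
open import Data.Nat using (ℕ; _+_; _*_; _∸_; _^_; _≤_)
open import Data.Nat.Divisibility using (_∣_)
open import Data.Nat.Primality using (Prime)
open import Data.Nat.GCD using (gcd)
open import Relation.Binary.PropositionalEquality using (_≡_)

import Data.Nat as ℕ
import Data.Nat.Properties as ℕP
open import Data.Nat using (suc; pred; NonZero)
open import Data.Nat.DivMod using (_/_; m/n*n≡m; m*n/n≡m)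
open import Data.Nat.Divisibility using (divides)
open import Data.Nat.GCD using (gcd[m,n]∣m)
open import Data.Product using (_,_; proj₂)
open import Data.Vec using (lookup)
open import Data.Integer as ℤ using ()
open import Data.Rational as ℚ using ()
open import Relation.Binary.PropositionalEquality using (refl; sym; trans; cong; subst; module ≡-Reasoning)
open FiniteFields
open NumberTheory
open CyclotomicMapping
open ClosedForm
open Counting using (exactHits)

probValueSetSize≡count/q^ℓ : ∀ F γ ℓ r N d → FiniteField.size F ^ ℓ ≡ suc d →
  probValueSetSize F γ ℓ r N ≡ ℤ.+ countBy (λ c → valueSetSize F (cyclotomicMap F γ ℓ r (λ i → FiniteField.enum F (lookup c i))) ℕ.≟ N)
                                             (allVecs (FiniteField.size F) ℓ) ℚ./ suc d
probValueSetSize≡count/q^ℓ F γ ℓ r N d eq with FiniteField.size F ^ ℓ | eq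
... | .(suc d) | refl = refl

module _ (F : FiniteField) (γ : FiniteField.Carrier F) (prim : FiniteField.IsPrimitive F γ) where
  open FiniteField F using (size)
  open PrimitiveElement F γ prim using (ord; ord-nonZero; size≡1+ord)

  private
    probValueSetSize≡rhs′ : ∀ ℓ′ r t′ w′ → ord ≡ (suc w′ * suc t′) * suc ℓ′ → suc t′ ≡ gcd r (suc w′ * suc t′) → ∀ k →
      probValueSetSize F γ (suc ℓ′) r (1 + k * suc w′) ≡ rhs (suc ord) (suc ℓ′) (suc w′ * suc t′) (suc t′) k
    probValueSetSize≡rhs′ ℓ′ r t′ w′ ord≡sℓ t≡gcd k = begin
      probValueSetSize F γ ℓ r (1 + k * suc w′)          ≡⟨ probValueSetSize≡count/q^ℓ F γ ℓ r _ d size^ℓ≡1+d ⟩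
      ℤ.+ count ℚ./ suc d                                ≡⟨ cong (λ n → ℤ.+ n ℚ./ suc d) (count-valueSetSize k) ⟩
      ℤ.+ exactHits (suc t′ * ℓ) (suc w′) ℓ k ℚ./ suc d  ≡⟨ A/q^ℓ≡A*u^ℓ ord t′ (suc w′) (exactHits (suc t′ * ℓ) (suc w′) ℓ k) ℓ d q^ℓ≡1+d ⟩
      ι (exactHits (suc t′ * ℓ) (suc w′) ℓ k) ℚ.* u ^ℚ ℓ ≡⟨ sym (rhs≡exactHits*u^ℓ ord t′ (suc w′) ℓ k) ⟩
      rhs (suc ord) ℓ (suc w′ * suc t′) (suc t′) k       ∎
      where
      open ≡-Reasoning
      ℓ = suc ℓ′
      s = suc w′ * suc t′
      u = ℤ.+ 1 ℚ./ suc ord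
      open Classes F γ prim ℓ (divides s ord≡sℓ)
      open ValueSet r (suc t′) w′ (subst (_∣ r) (sym t≡gcd) (gcd[m,n]∣m r s)) ord≡sℓ
                    (proj₂ (proj₂ (proj₂ (gcd-lincomb r s (suc t′) t≡gcd)))) using (count-valueSetSize)
      count = countBy (λ c → valueSetSize F (cyclotomicMap F γ ℓ r (λ i → FiniteField.enum F (lookup c i))) ℕ.≟ (1 + k * suc w′))
                      (allVecs size ℓ)
      d = pred (suc ord ^ ℓ)
      q^ℓ≡1+d : suc ord ^ ℓ ≡ suc d
      q^ℓ≡1+d = sym (ℕP.suc-pred (suc ord ^ ℓ) {{ℕP.m^n≢0 (suc ord) ℓ}})
      size^ℓ≡1+d : size ^ ℓ ≡ suc d
      size^ℓ≡1+d = trans (cong (_^ ℓ) size≡1+ord) q^ℓ≡1+d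

  probValueSetSize≡rhs : ∀ ℓ′ r s t → ord ≡ s * suc ℓ′ → t ≡ gcd r s → ∀ k →
    probValueSetSize F γ (suc ℓ′) r (1 + k * (s divℕ t)) ≡ rhs (suc ord) (suc ℓ′) s t k
  probValueSetSize≡rhs ℓ′ r s t ord≡sℓ t≡gcd k with gcd-cofactor r s t {{s≢0}} t≡gcd
    where s≢0 = ℕP.m*n≢0⇒m≢0 s {{subst NonZero ord≡sℓ ord-nonZero}}
  ... | t′ , w′ , refl , refl = trans (cong (λ w → probValueSetSize F γ (suc ℓ′) r (1 + k * w)) (m*n/n≡m (suc w′) (suc t′)))
                                      (probValueSetSize≡rhs′ ℓ′ r t′ w′ ord≡sℓ t≡gcd k)

theorem4p2 : (F : FiniteField) (q : ℕ) → FiniteField.size F ≡ q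
    → (p e : ℕ) → Prime p → 1 ≤ e → q ≡ p ^ e
    → (γ : FiniteField.Carrier F) → FiniteField.IsPrimitive F γ
    → (ℓ : ℕ) → 1 ≤ ℓ → ℓ ∣ (q ∸ 1)
    → (s : ℕ) → s ≡ (q ∸ 1) divℕ ℓ
    → (r : ℕ) → 1 ≤ r
    → (t : ℕ) → t ≡ gcd r s
    → (k : ℕ) → k ≤ t * ℓ
    → probValueSetSize F γ ℓ r (1 + k * (s divℕ t)) ≡ rhs q ℓ s t k
theorem4p2 F q size≡q _ _ _ _ _ γ prim ℓ@(suc ℓ′) _ ℓ∣q∸1 s s≡[q∸1]/ℓ r _ t t≡gcd k _ =
  trans (probValueSetSize≡rhs F γ prim ℓ′ r s t ord≡s*ℓ t≡gcd k) (cong (λ q → rhs q ℓ s t k) (sym q≡1+ord))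
  where
  open PrimitiveElement F γ prim using (ord; size≡1+ord)
  q≡1+ord : q ≡ suc ord
  q≡1+ord = trans (sym size≡q) size≡1+ord
  ord≡s*ℓ : ord ≡ s * ℓ
  ord≡s*ℓ = sym (trans (cong (_* ℓ) s≡[q∸1]/ℓ) (trans (cong (λ n → (n ∸ 1) / ℓ * ℓ) q≡1+ord)
                (m/n*n≡m (subst (λ n → ℓ ∣ n ∸ 1) q≡1+ord ℓ∣q∸1))))
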